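{- Let $n\ge 3$ and $k\in\{2,3,\ldots,n-1\}$, and let $C_n$ be the cycle on $n$ vertices. Then ${\rm sgp}_k(C_n)=k$ if $\lfloor 2n/3\rfloor\le k\le n-2$, and ${\rm sgp}_k(C_n)=k+1$ otherwise.
   Context: For a nonempty $W\subseteq V(G)$ of a graph $G$, the Steiner distance $d_G(W)$ is the minimum number of edges of a connected subgraph of $G$ containing $W$; such a minimum subgraph is a tree, called a Steiner $W$-tree. For a positive integer $k$, a set $A\subseteq V(G)$ is a $k$-Steiner general position set if for every $B\subseteq A$ with $|B|=k$ and every Steiner $B$-tree $T_B$ we have $V(T_B)\cap A=B$. ${\rm sgp}_k(G)$ is the largest cardinality of a $k$-Steiner general position set of $G$. -}

module Defs where

open import Data.Nat using (ℕ; zero; suc; _+_; _≤_; _<ᵇ_)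
open import Data.Bool using (Bool; true; false; _∧_; if_then_else_)
open import Data.Fin using (Fin; toℕ)
open import Data.Fin.Subset using (Subset; _∈_; _⊆_; _∩_; ∣_∣)
open import Data.List using (map; allFin)
open import Data.Nat.ListAction using (sum)
open import Data.Product using (Σ; _×_; _,_)
open import Data.Sum using (_⊎_)
open import Relation.Binary.PropositionalEquality using (_≡_)
open import Relation.Nullary using (¬_)
import Data.Empty

record Graph (n : ℕ) : Set₁ where
  field
    Adj     : Fin n → Fin n → Set
    Adj-sym : ∀ {i j} → Adj i j → Adj j i
    Adj-irr : ∀ {i} → ¬ Adj i i
open Graph public

CycAdj : (n : ℕ) → Fin n → Fin n → Set
CycAdj n i j =
  (toℕ j ≡ suc (toℕ i)) ⊎ (toℕ i ≡ suc (toℕ j))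
  ⊎ ((toℕ i ≡ 0 × suc (toℕ j) ≡ n) ⊎ (toℕ j ≡ 0 × suc (toℕ i) ≡ n))

-- Irreflexivity requires n ≥ 2 (for n = 1 vertex 0 would be a loop); we
-- only use the cycle for n ≥ 3, so we take n = 3 + m.
Cycle : (m : ℕ) → Graph (3 + m)
Cycle m = record { Adj = CycAdj (3 + m) ; Adj-sym = sym′ ; Adj-irr = irr }
  where
  open import Data.Sum using (inj₁; inj₂)
  open import Data.Nat.Properties using (1+n≢n)
  open import Relation.Binary.PropositionalEquality using (sym)
  sym′ : ∀ {i j} → CycAdj (3 + m) i j → CycAdj (3 + m) j i
  sym′ (inj₁ p) = inj₂ (inj₁ p)
  sym′ (inj₂ (inj₁ p)) = inj₁ p
  sym′ (inj₂ (inj₂ (inj₁ p))) = inj₂ (inj₂ (inj₂ p))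
  sym′ (inj₂ (inj₂ (inj₂ p))) = inj₂ (inj₂ (inj₁ p))
  irr : ∀ {i} → ¬ CycAdj (3 + m) i i
  irr {i} (inj₁ p) = 1+n≢n (sym p)
  irr {i} (inj₂ (inj₁ p)) = 1+n≢n (sym p)
  irr {i} (inj₂ (inj₂ (inj₁ (p , q)))) = lemma p q
    where
    lemma : toℕ i ≡ 0 → suc (toℕ i) ≡ 3 + m → Data.Empty.⊥
    lemma p q rewrite p with q
    ... | ()
  irr {i} (inj₂ (inj₂ (inj₂ (p , q)))) = lemma p q
    where
    lemma : toℕ i ≡ 0 → suc (toℕ i) ≡ 3 + m → Data.Empty.⊥
    lemma p q rewrite p with q
    ... | ()

record Subgraph {n : ℕ} (G : Graph n) : Set where
  field
    V     : Subset n
    E     : Fin n → Fin n → Bool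
    E-sym : ∀ i j → E i j ≡ E j i
    E-adj : ∀ i j → E i j ≡ true → Adj G i j
    E-V   : ∀ i j → E i j ≡ true → i ∈ V
open Subgraph public

edgeCount : ∀ {n} {G : Graph n} → Subgraph G → ℕ
edgeCount {n} H =
  sum (map (λ i → sum (map (λ j → if (toℕ i <ᵇ toℕ j) ∧ E H i j then 1 else 0)
                           (allFin n)))
           (allFin n))

data Walk {n : ℕ} {G : Graph n} (H : Subgraph G) : Fin n → Fin n → Set where
  here : ∀ {x} → Walk H x x
  step : ∀ {x y z} → E H x y ≡ true → Walk H y z → Walk H x z

Connected : ∀ {n} {G : Graph n} → Subgraph G → Set
Connected H = ∀ x y → x ∈ V H → y ∈ V H → Walk H x y

ConnContaining : ∀ {n} (G : Graph n) → Subset n → Subgraph G → Set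
ConnContaining G W H = Connected H × W ⊆ V H

-- A Steiner W-tree: a connected subgraph containing W with the minimum
-- number of edges (such a subgraph is necessarily a tree).
SteinerTree : ∀ {n} (G : Graph n) → Subset n → Subgraph G → Set
SteinerTree G W T =
  ConnContaining G W T × (∀ H → ConnContaining G W H → edgeCount T ≤ edgeCount H)

IsSGPSet : ∀ {n} (G : Graph n) (k : ℕ) → Subset n → Set
IsSGPSet G k A =
  ∀ B → B ⊆ A → ∣ B ∣ ≡ k → ∀ T → SteinerTree G B T → V T ∩ A ≡ B

SgpIs : ∀ {n} (G : Graph n) (k s : ℕ) → Set
SgpIs G k s =
  Σ (Subset _) (λ A → IsSGPSet G k A × ∣ A ∣ ≡ s)
  × (∀ A → IsSGPSet G k A → ∣ A ∣ ≤ s)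

module Submission where

-- The edges missing from a connected subgraph H ⊇ S of the cycle all lie in one gap of S
-- (consecutive edges with no vertex of S strictly inside), so H has at least n − ℓ edges,
-- ℓ the length of a longest gap, and deleting a longest gap of S leaves a Steiner S-tree.
-- Upper bounds: among k + 2 points, delete the second from the first k + 1 to get B; the
-- gap deleted for B must contain the second and the last point, hence the first or the
-- third as well. If 3(k + 1) > 2n and k + 1 < n, a set of k + 1 points has three consecutive
-- vertices; deleting the middle one, a longest gap of A is also a longest gap of B, and its
-- path avoids the middle vertex. Lower bounds: k points always work, and otherwise k + 1
-- evenly spread points work, because a Steiner tree through a point of A ∖ B would contain
-- all of A and so miss only a short gap, while the gap of B around that point is long.

open import Defs
open import Data.Nat hiding (∣_-_∣)
open import Data.Nat.Properties
open import Data.Nat.DivMod using (_/_; _%_; m≡m%n+[m/n]*n; m%n<n; m/n*n≤m; m*n/n≡m; m<n*o⇒m/o<n; /-monoˡ-≤; +-distrib-/-∣ʳ)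
open import Data.Nat.Divisibility using (divides)
open import Data.Nat.Tactic.RingSolver using (solve-∀)
import Data.Nat.ListAction as ListAction
open import Algebra.Properties.CommutativeMonoid.Sum +-0-commutativeMonoid using (sum; sum-cong-≗; sum-replicate-zero; ∑-distrib-+; ∑-comm)
open import Algebra.Properties.CommutativeSemigroup +-commutativeSemigroup
  using () renaming (interchange to +-interchange; xy∙z≈xz∙y to +-xy∙z≈xz∙y)
open import Data.Bool using (Bool; true; false; not; _∧_; _∨_; if_then_else_)
open import Data.Bool.Properties using (T-≡; ∧-identityʳ; ∧-zeroʳ; ∨-zeroʳ; ∨-identityʳ; ∨-comm; not-injective)
import Data.Bool.Properties as Bool
open import Data.Empty using (⊥; ⊥-elim)
open import Data.Fin using (Fin; toℕ; fromℕ<) renaming (zero to fzero; suc to fsuc)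
import Data.Fin.Properties as Fin
open import Data.Fin.Subset using (Subset; ⊤; _∈_; _∉_; _⊆_; _∩_; _-_; ∣_∣)
open import Data.Fin.Subset.Properties
  using (_∈?_; p─⊥≡p; p⊂q⇒∣p∣<∣q∣; p⊆q⇒∣p∣≤∣q∣; ∣⊤∣≡n; ⊆-antisym; x∈p∩q⁺; x∈p∩q⁻; p─q⊆p; x∈p∧x≢y⇒x∈p-y; p∩q⊆p; p∩q⊆q)
open import Data.List using (map; allFin)
import Data.List as List
open import Data.List.Properties using (map-tabulate)
open import Data.Product using (Σ; _×_; _,_; proj₁; proj₂)
open import Data.Sum using (_⊎_; inj₁; inj₂)
open import Data.Vec using (lookup; tabulate; []; _∷_; here; there)
open import Data.Vec.Properties using (lookup∘tabulate; lookup⇒[]=; []=⇒lookup; lookup-zipWith)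
open import Function using (_∘_)
open import Function.Bundles using (Equivalence)
open import Relation.Binary.Definitions using (tri<; tri≈; tri>)
open import Relation.Binary.PropositionalEquality
open import Relation.Nullary using (¬_; ¬?; Dec; yes; no; does)
open import Relation.Nullary.Decidable using (dec-true; dec-false; decidable-stable; _×-dec_; _→-dec_)
open import Relation.Nullary.Negation using (contradiction)
open import Relation.Nullary.Reflects using (ofʸ)
open import Relation.Unary using (Decidable)

false≢true : false ≢ true
false≢true ()

¬true⇒false : ∀ {b} → ¬ b ≡ true → b ≡ false
¬true⇒false {true} ¬t = ⊥-elim (¬t refl)
¬true⇒false {false} _ = refl

∨≡true : ∀ {a b} → a ∨ b ≡ true → a ≡ true ⊎ b ≡ true
∨≡true {true} _ = inj₁ refl
∨≡true {false} e = inj₂ e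

∧≡true : ∀ {a b} → a ∧ b ≡ true → a ≡ true × b ≡ true
∧≡true {true} e = refl , e

m<n⇒m<ᵇn≡true : ∀ {m n} → m < n → (m <ᵇ n) ≡ true
m<n⇒m<ᵇn≡true m<n = Equivalence.to T-≡ (<⇒<ᵇ m<n)

n≤m⇒m<ᵇn≡false : ∀ {m n} → n ≤ m → (m <ᵇ n) ≡ false
n≤m⇒m<ᵇn≡false {m} {n} n≤m with m <ᵇ n | <ᵇ-reflects-< m n
... | true | ofʸ m<n = contradiction n≤m (<⇒≱ m<n)
... | false | _ = refl

m<ᵇn≡true⇒m<n : ∀ {m n} → (m <ᵇ n) ≡ true → m < n
m<ᵇn≡true⇒m<n {m} {n} e = <ᵇ⇒< m n (Equivalence.from T-≡ e)

<ᵇ-+ʳ : ∀ a b c → (a + c <ᵇ b + c) ≡ (a <ᵇ b)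
<ᵇ-+ʳ a b c with a <? b
... | yes a<b = trans (m<n⇒m<ᵇn≡true (+-monoˡ-< c a<b)) (sym (m<n⇒m<ᵇn≡true a<b))
... | no a≮b = trans (n≤m⇒m<ᵇn≡false (+-monoˡ-≤ c (≮⇒≥ a≮b))) (sym (n≤m⇒m<ᵇn≡false (≮⇒≥ a≮b)))

_==_ : ∀ {N} → Fin N → Fin N → Bool
a == b = does (a Fin.≟ b)

==-refl : ∀ {N} (a : Fin N) → (a == a) ≡ true
==-refl a = dec-true (a Fin.≟ a) refl

≢⇒==≡false : ∀ {N} {a b : Fin N} → a ≢ b → (a == b) ≡ false
≢⇒==≡false {a = a} {b} = dec-false (a Fin.≟ b)

==≡true⇒≡ : ∀ {N} {a b : Fin N} → (a == b) ≡ true → a ≡ b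
==≡true⇒≡ {a = a} {b} e with a Fin.≟ b
... | yes a≡b = a≡b

n≤m<n+o⇒m∸n<o : ∀ {m n o} → n ≤ m → m < n + o → m ∸ n < o
n≤m<n+o⇒m∸n<o {m} {n} {o} n≤m m<n+o = subst (m ∸ n <_) (m+n∸m≡n n o) (∸-monoˡ-< m<n+o n≤m)

m<[1+m/n]*n : ∀ m n .{{_ : NonZero n}} → m < suc (m / n) * n
m<[1+m/n]*n m n = begin-strict
  m                   ≡⟨ m≡m%n+[m/n]*n m n ⟩
  m % n + (m / n) * n <⟨ +-monoˡ-< ((m / n) * n) (m%n<n m n) ⟩
  n + (m / n) * n     ∎
  where open ≤-Reasoning

[m+k*n]/n≡m/n+k : ∀ m k n .{{_ : NonZero n}} → (m + k * n) / n ≡ m / n + k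
[m+k*n]/n≡m/n+k m k n = trans (+-distrib-/-∣ʳ m (divides k refl)) (cong (m / n +_) (m*n/n≡m k n))

least : ∀ (P : ℕ → Set) → Decidable P → ∀ w → P w →
  Σ ℕ (λ z → P z × z ≤ w × (∀ z′ → z′ < z → ¬ P z′))
least P P? w pw = go w 0 refl (λ z′ ())
  where
  go : ∀ d k → k + d ≡ w → (∀ z′ → z′ < k → ¬ P z′) → Σ ℕ (λ z → P z × z ≤ w × (∀ z′ → z′ < z → ¬ P z′))
  go d k eq below with P? k
  ... | yes pk = k , pk , subst (k ≤_) eq (m≤m+n k d) , below
  go zero k eq below | no ¬pk = ⊥-elim (¬pk (subst P (trans (sym eq) (+-identityʳ k)) pw))
  go (suc d) k eq below | no ¬pk = go d (suc k) (trans (sym (+-suc k d)) eq) below′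
    where
    below′ : ∀ z′ → z′ < suc k → ¬ P z′
    below′ z′ z′<sk with m≤n⇒m<n∨m≡n (s≤s⁻¹ z′<sk)
    ... | inj₁ z′<k = below z′ z′<k
    ... | inj₂ refl = ¬pk

greatest : ∀ (Q : ℕ → Set) → Decidable Q → ∀ B z₀ → Q z₀ → (∀ z → Q z → z ≤ B) →
  Σ ℕ (λ z → Q z × (∀ z′ → Q z′ → z′ ≤ z))
greatest Q Q? B z₀ qz₀ bound = go B bound
  where
  go : ∀ j → (∀ z → Q z → z ≤ j) → Σ ℕ (λ z → Q z × (∀ z′ → Q z′ → z′ ≤ z))
  go j above with Q? j
  ... | yes qj = j , qj , above
  go zero above | no ¬qj = ⊥-elim (¬qj (subst Q (n≤0⇒n≡0 (above z₀ qz₀)) qz₀))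
  go (suc j) above | no ¬qj = go j above′
    where
    above′ : ∀ z → Q z → z ≤ j
    above′ z qz with m≤n⇒m<n∨m≡n (above z qz)
    ... | inj₁ z<sj = s≤s⁻¹ z<sj
    ... | inj₂ refl = ⊥-elim (¬qj qz)

-- Finite sums

𝟙 : Bool → ℕ
𝟙 b = if b then 1 else 0

𝟙≤1 : ∀ b → 𝟙 b ≤ 1
𝟙≤1 true = ≤-refl
𝟙≤1 false = z≤n

𝟙+𝟙∘not≡1 : ∀ b → 𝟙 b + 𝟙 (not b) ≡ 1
𝟙+𝟙∘not≡1 true = refl
𝟙+𝟙∘not≡1 false = refl

∑-mono-≤ : ∀ {N} {f g : Fin N → ℕ} → (∀ x → f x ≤ g x) → sum f ≤ sum g
∑-mono-≤ {zero} h = z≤n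
∑-mono-≤ {suc N} h = +-mono-≤ (h fzero) (∑-mono-≤ (λ x → h (fsuc x)))

∑-zero : ∀ {N} {f : Fin N → ℕ} → (∀ x → f x ≡ 0) → sum f ≡ 0
∑-zero {N} h = trans (sum-cong-≗ h) (sum-replicate-zero N)

∑-point : ∀ {N} (f : Fin N → ℕ) a → (∀ x → x ≢ a → f x ≡ 0) → sum f ≡ f a
∑-point f fzero h = trans (cong (f fzero +_) (∑-zero (λ x → h (fsuc x) (λ ())))) (+-identityʳ _)
∑-point f (fsuc a) h rewrite h fzero (λ ()) =
  ∑-point (λ x → f (fsuc x)) a (λ x x≢a → h (fsuc x) (λ e → x≢a (Fin.suc-injective e)))

∑𝟙[x==a]≡1 : ∀ {N} (a : Fin N) → sum (λ x → 𝟙 (x == a)) ≡ 1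
∑𝟙[x==a]≡1 a = trans (∑-point _ a (λ x x≢a → cong 𝟙 (≢⇒==≡false x≢a))) (cong 𝟙 (==-refl a))

∑-const-1 : ∀ N → sum {N} (λ _ → 1) ≡ N
∑-const-1 zero = refl
∑-const-1 (suc N) = cong suc (∑-const-1 N)

∑𝟙+∑𝟙∘not : ∀ {N} (b : Fin N → Bool) → sum (λ x → 𝟙 (b x)) + sum (λ x → 𝟙 (not (b x))) ≡ N
∑𝟙+∑𝟙∘not {N} b = begin
  sum (λ x → 𝟙 (b x)) + sum (λ x → 𝟙 (not (b x))) ≡⟨ ∑-distrib-+ (λ x → 𝟙 (b x)) (λ x → 𝟙 (not (b x))) ⟨
  sum (λ x → 𝟙 (b x) + 𝟙 (not (b x)))              ≡⟨ sum-cong-≗ (λ x → 𝟙+𝟙∘not≡1 (b x)) ⟩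
  sum {N} (λ _ → 1)                                ≡⟨ ∑-const-1 N ⟩
  N                                                ∎
  where
  open ≡-Reasoning

listSum-allFin : ∀ N (f : Fin N → ℕ) → ListAction.sum (map f (allFin N)) ≡ sum f
listSum-allFin N f = trans (cong ListAction.sum (map-tabulate (λ x → x) f)) (go N f)
  where
  go : ∀ N (f : Fin N → ℕ) → ListAction.sum (List.tabulate f) ≡ sum f
  go zero f = refl
  go (suc N) f = cong (f fzero +_) (go N (λ x → f (fsuc x)))

sum< : ℕ → (ℕ → ℕ) → ℕ
sum< zero f = 0
sum< (suc N) f = sum< N f + f N

sum<-cong : ∀ N {f g} → (∀ z → z < N → f z ≡ g z) → sum< N f ≡ sum< N g
sum<-cong zero h = refl
sum<-cong (suc N) h = cong₂ _+_ (sum<-cong N (λ z z<N → h z (m<n⇒m<1+n z<N))) (h N ≤-refl)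

sum<-mono-≤ : ∀ N {f g} → (∀ z → z < N → f z ≤ g z) → sum< N f ≤ sum< N g
sum<-mono-≤ zero h = z≤n
sum<-mono-≤ (suc N) h = +-mono-≤ (sum<-mono-≤ N (λ z z<N → h z (m<n⇒m<1+n z<N))) (h N ≤-refl)

sum<-distrib-+ : ∀ N f g → sum< N (λ z → f z + g z) ≡ sum< N f + sum< N g
sum<-distrib-+ zero f g = refl
sum<-distrib-+ (suc N) f g rewrite sum<-distrib-+ N f g = +-interchange (sum< N f) (sum< N g) (f N) (g N)

sum<-zero : ∀ N f → (∀ z → z < N → f z ≡ 0) → sum< N f ≡ 0
sum<-zero zero f h = refl
sum<-zero (suc N) f h rewrite sum<-zero N f (λ z z<N → h z (m<n⇒m<1+n z<N)) | h N ≤-refl = refl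

sum<-const : ∀ N c → sum< N (λ _ → c) ≡ N * c
sum<-const zero c = refl
sum<-const (suc N) c rewrite sum<-const N c = +-comm (N * c) c

sum<-suc : ∀ N f → sum< (suc N) f ≡ f 0 + sum< N (λ z → f (suc z))
sum<-suc zero f = sym (+-identityʳ (f 0))
sum<-suc (suc N) f rewrite sum<-suc N f = +-assoc (f 0) _ _

∑∘toℕ≡sum< : ∀ N g → sum {N} (λ x → g (toℕ x)) ≡ sum< N g
∑∘toℕ≡sum< zero g = refl
∑∘toℕ≡sum< (suc N) g = trans (cong (g 0 +_) (∑∘toℕ≡sum< N (λ z → g (suc z)))) (sym (sum<-suc N g))

sum<-truncate : ∀ N y g → y ≤ N → sum< N (λ z → if z <ᵇ y then g z else 0) ≡ sum< y g
sum<-truncate N zero g y≤N = sum<-zero N _ (λ z _ → refl)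
sum<-truncate (suc N) (suc y) g (s≤s y≤N) with m≤n⇒m<n∨m≡n y≤N
... | inj₁ y<N = trans (cong₂ _+_ (sum<-truncate N (suc y) g y<N) (dropped N y<N)) (+-identityʳ _)
  where
  dropped : ∀ a → suc y ≤ a → (if a <ᵇ suc y then g a else 0) ≡ 0
  dropped a sy≤a rewrite n≤m⇒m<ᵇn≡false sy≤a = refl
... | inj₂ refl = cong₂ _+_ (sum<-cong N (λ z z<N → kept z (m<n⇒m<1+n z<N))) (kept N ≤-refl)
  where
  kept : ∀ a → a < suc N → (if a <ᵇ suc N then g a else 0) ≡ g a
  kept a a<sN rewrite m<n⇒m<ᵇn≡true a<sN = refl

sum<-telescope : ∀ (D : ℕ → ℕ) → (∀ z → D z ≤ D (suc z)) → ∀ x w →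
  sum< w (λ i → D (suc (x + i)) ∸ D (x + i)) + D x ≡ D (x + w)
sum<-telescope D mono x zero rewrite +-identityʳ x = refl
sum<-telescope D mono x (suc w) rewrite +-suc x w = begin
  sum< w Δ + (D (suc (x + w)) ∸ D (x + w)) + D x ≡⟨ +-xy∙z≈xz∙y (sum< w Δ) _ (D x) ⟩
  sum< w Δ + D x + (D (suc (x + w)) ∸ D (x + w)) ≡⟨ cong (_+ (D (suc (x + w)) ∸ D (x + w))) (sum<-telescope D mono x w) ⟩
  D (x + w) + (D (suc (x + w)) ∸ D (x + w))      ≡⟨ m+[n∸m]≡n (mono (x + w)) ⟩
  D (suc (x + w))                               ∎
  where
  open ≡-Reasoning
  Δ : ℕ → ℕ
  Δ i = D (suc (x + i)) ∸ D (x + i)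

sum<-rotate : ∀ N f → (∀ z → f (N + z) ≡ f z) → ∀ c → sum< N (λ z → f (c + z)) ≡ sum< N f
sum<-rotate N f periodic zero = refl
sum<-rotate N f periodic (suc c) = trans (+-cancelʳ-≡ (g 0) _ _ one-step) (sum<-rotate N f periodic c)
  where
  g : ℕ → ℕ
  g z = f (c + z)
  one-step : sum< N (λ z → f (suc c + z)) + g 0 ≡ sum< N g + g 0
  one-step = begin
    sum< N (λ z → f (suc c + z)) + g 0 ≡⟨ cong (_+ g 0) (sum<-cong N (λ z _ → cong f (sym (+-suc c z)))) ⟩
    sum< N (λ z → g (suc z)) + g 0     ≡⟨ +-comm _ (g 0) ⟩
    g 0 + sum< N (λ z → g (suc z))     ≡⟨ sum<-suc N g ⟨
    sum< N g + g N                     ≡⟨ cong (sum< N g +_) (trans (cong f (+-comm c N)) (trans (periodic c) (cong f (sym (+-identityʳ c))))) ⟩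
    sum< N g + g 0                     ∎
    where open ≡-Reasoning

-- Subsets

∣p∣≡∑𝟙 : ∀ {N} (p : Subset N) → ∣ p ∣ ≡ sum (λ x → 𝟙 (lookup p x))
∣p∣≡∑𝟙 [] = refl
∣p∣≡∑𝟙 (true ∷ p) = cong suc (∣p∣≡∑𝟙 p)
∣p∣≡∑𝟙 (false ∷ p) = ∣p∣≡∑𝟙 p

x∉p-x : ∀ {N} {p : Subset N} (x : Fin N) → x ∉ p - x
x∉p-x {p = true ∷ p} fzero ()
x∉p-x {p = false ∷ p} fzero ()
x∉p-x {p = _ ∷ p} (fsuc x) (there x∈p-x) = x∉p-x {p = p} x x∈p-x

∣p-x∣+1≡∣p∣ : ∀ {N} {p : Subset N} {x} → x ∈ p → suc ∣ p - x ∣ ≡ ∣ p ∣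
∣p-x∣+1≡∣p∣ {p = true ∷ p} here = cong (λ q → suc ∣ q ∣) (p─⊥≡p p)
∣p-x∣+1≡∣p∣ {p = true ∷ p} (there x∈p) = cong suc (∣p-x∣+1≡∣p∣ x∈p)
∣p-x∣+1≡∣p∣ {p = false ∷ p} (there x∈p) = ∣p-x∣+1≡∣p∣ x∈p

p⊆q∧∣q∣≤∣p∣⇒q⊆p : ∀ {N} {p q : Subset N} → p ⊆ q → ∣ q ∣ ≤ ∣ p ∣ → q ⊆ p
p⊆q∧∣q∣≤∣p∣⇒q⊆p {p = p} p⊆q ∣q∣≤∣p∣ {x} x∈q with x ∈? p
... | yes x∈p = x∈p
... | no x∉p = ⊥-elim (<⇒≱ (p⊂q⇒∣p∣<∣q∣ (p⊆q , x , x∈q , x∉p)) ∣q∣≤∣p∣)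

∣p∣<N⇒∃∉ : ∀ {N} (p : Subset N) → ∣ p ∣ < N → Σ (Fin N) (_∉ p)
∣p∣<N⇒∃∉ {N} p ∣p∣<N with Fin.any? (λ x → ¬? (x ∈? p))
... | yes x∉p = x∉p
... | no none = ⊥-elim (<⇒≱ ∣p∣<N (subst (_≤ ∣ p ∣) (∣⊤∣≡n N) (p⊆q⇒∣p∣≤∣q∣ {p = ⊤} (λ {x} _ → decidable-stable (x ∈? p) (λ x∉p → none (x , x∉p))))))

below : ∀ {N} → ℕ → Subset N
below y = tabulate (λ v → toℕ v <ᵇ y)

∈below : ∀ {N y} {v : Fin N} → toℕ v < y → v ∈ below y
∈below {y = y} {v} v<y = lookup⇒[]= v (below y) (trans (lookup∘tabulate (λ v → toℕ v <ᵇ y) v) (m<n⇒m<ᵇn≡true v<y))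

∈below⁻ : ∀ {N y} {v : Fin N} → v ∈ below y → toℕ v < y
∈below⁻ {y = y} {v} v∈ with toℕ v <? y
... | yes v<y = v<y
... | no v≮y = ⊥-elim (false≢true (trans (sym (n≤m⇒m<ᵇn≡false (≮⇒≥ v≮y)))
                 (trans (sym (lookup∘tabulate (λ v → toℕ v <ᵇ y) v)) ([]=⇒lookup v∈))))

∣below∣ : ∀ {N} y → y ≤ N → ∣ below {N} y ∣ ≡ y
∣below∣ {N} y y≤N = begin
  ∣ below {N} y ∣                      ≡⟨ ∣p∣≡∑𝟙 (below {N} y) ⟩
  sum (λ v → 𝟙 (lookup (below {N} y) v)) ≡⟨ sum-cong-≗ {N} (λ v → cong 𝟙 (lookup∘tabulate (λ v → toℕ v <ᵇ y) v)) ⟩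
  sum {N} (λ v → 𝟙 (toℕ v <ᵇ y))       ≡⟨ ∑∘toℕ≡sum< N (λ z → 𝟙 (z <ᵇ y)) ⟩
  sum< N (λ z → 𝟙 (z <ᵇ y))            ≡⟨ sum<-truncate N y (λ _ → 1) y≤N ⟩
  sum< y (λ _ → 1)                     ≡⟨ sum<-const y 1 ⟩
  y * 1                                ≡⟨ *-identityʳ y ⟩
  y                                    ∎
  where open ≡-Reasoning

-- Walks and Steiner general position in an arbitrary graph

module _ {N} {G : Graph N} {H : Subgraph G} where

  _++ʷ_ : ∀ {x y z} → Walk H x y → Walk H y z → Walk H x z
  here ++ʷ w = w
  step e u ++ʷ w = step e (u ++ʷ w)

  reverseʷ : ∀ {x y} → Walk H x y → Walk H y x
  reverseʷ here = here
  reverseʷ {x} (step {y = y} e w) = reverseʷ w ++ʷ step (trans (E-sym H y x) e) here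

IsSGPSet-intro : ∀ {N} (G : Graph N) k (A : Subset N) →
  (∀ B → B ⊆ A → ∣ B ∣ ≡ k → ∀ T → SteinerTree G B T → ∀ {x} → x ∈ A → x ∉ B → x ∉ V T) →
  IsSGPSet G k A
IsSGPSet-intro G k A excluded B B⊆A ∣B∣≡k T tree@((_ , B⊆V) , _) = ⊆-antisym ⊆B (λ x∈B → x∈p∩q⁺ (B⊆V x∈B , B⊆A x∈B))
  where
  ⊆B : V T ∩ A ⊆ B
  ⊆B {x} x∈V∩A with x∈p∩q⁻ (V T) A x∈V∩A | x ∈? B
  ... | _ , _ | yes x∈B = x∈B
  ... | x∈V , x∈A | no x∉B = ⊥-elim (excluded B B⊆A ∣B∣≡k T tree x∈A x∉B x∈V)

IsSGPSet-of-size : ∀ {N} (G : Graph N) k (A : Subset N) → ∣ A ∣ ≡ k → IsSGPSet G k A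
IsSGPSet-of-size G k A ∣A∣≡k = IsSGPSet-intro G k A λ B B⊆A ∣B∣≡k T _ x∈A x∉B _ →
  x∉B (p⊆q∧∣q∣≤∣p∣⇒q⊆p B⊆A (≤-reflexive (trans ∣A∣≡k (sym ∣B∣≡k))) x∈A)

module Positions (m : ℕ) where
  n : ℕ
  n = 3 + m

  next : Fin n → Fin n
  next i with suc (toℕ i) <? n
  ... | yes p = fromℕ< p
  ... | no _ = fzero

  toℕ-next : ∀ i → (toℕ (next i) ≡ suc (toℕ i) × suc (toℕ i) < n) ⊎ (toℕ (next i) ≡ 0 × suc (toℕ i) ≡ n)
  toℕ-next i with suc (toℕ i) <? n
  ... | yes p = inj₁ (Fin.toℕ-fromℕ< p , p)
  ... | no ¬p = inj₂ (refl , ≤-antisym (Fin.toℕ<n i) (≮⇒≥ ¬p))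

  -- vtx z is the vertex at position z, i.e. z mod n; the arguments reason about positions.
  vtx : ℕ → Fin n
  vtx zero = fzero
  vtx (suc z) = next (vtx z)

  toℕ-vtx : ∀ {z} → z < n → toℕ (vtx z) ≡ z
  toℕ-vtx {zero} _ = refl
  toℕ-vtx {suc z} sz<n with toℕ-next (vtx z)
  ... | inj₁ (e , _) = trans e (cong suc (toℕ-vtx (<-trans (n<1+n z) sz<n)))
  ... | inj₂ (_ , e) = ⊥-elim (<-irrefl (trans (cong suc (sym (toℕ-vtx (<-trans (n<1+n z) sz<n)))) e) sz<n)

  vtx-toℕ : ∀ x → vtx (toℕ x) ≡ x
  vtx-toℕ x = Fin.toℕ-injective (toℕ-vtx (Fin.toℕ<n x))

  vtx-n+ : ∀ z → vtx (n + z) ≡ vtx z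
  vtx-n+ zero = subst (λ t → vtx t ≡ fzero) (sym (+-identityʳ n)) vtx-n
    where
    vtx-n : vtx n ≡ fzero
    vtx-n with toℕ-next (vtx (2 + m))
    ... | inj₁ (_ , lt) = ⊥-elim (<-irrefl (cong suc (toℕ-vtx ≤-refl)) lt)
    ... | inj₂ (e , _) = Fin.toℕ-injective e
  vtx-n+ (suc z) = trans (cong vtx (+-suc n z)) (cong next (vtx-n+ z))

  vtx-*n+ : ∀ q z → vtx (q * n + z) ≡ vtx z
  vtx-*n+ zero z = refl
  vtx-*n+ (suc q) z = trans (cong vtx (+-assoc n (q * n) z)) (trans (vtx-n+ (q * n + z)) (vtx-*n+ q z))

  next-injective : ∀ {i j} → next i ≡ next j → i ≡ j
  next-injective {i} {j} e with toℕ-next i | toℕ-next j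
  ... | inj₁ (a , _) | inj₁ (b , _) = Fin.toℕ-injective (suc-injective (trans (sym a) (trans (cong toℕ e) b)))
  ... | inj₁ (a , _) | inj₂ (b , _) = ⊥-elim (1+n≢0 (trans (sym a) (trans (cong toℕ e) b)))
  ... | inj₂ (a , _) | inj₁ (b , _) = ⊥-elim (1+n≢0 (trans (sym b) (trans (cong toℕ (sym e)) a)))
  ... | inj₂ (_ , a) | inj₂ (_ , b) = Fin.toℕ-injective (suc-injective (trans a (sym b)))

  vtx-+ : ∀ {a b} z → vtx a ≡ vtx b → vtx (a + z) ≡ vtx (b + z)
  vtx-+ {a} {b} zero e rewrite +-identityʳ a | +-identityʳ b = e
  vtx-+ {a} {b} (suc z) e rewrite +-suc a z | +-suc b z = cong next (vtx-+ {a} {b} z e)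

  vtx-+≢ : ∀ y {d} → 0 < d → d < n → vtx (y + d) ≢ vtx y
  vtx-+≢ zero 0<d d<n e = <-irrefl (sym (trans (sym (toℕ-vtx d<n)) (cong toℕ e))) 0<d
  vtx-+≢ (suc y) 0<d d<n e = vtx-+≢ y 0<d d<n (next-injective e)

  vtx-injective-window : ∀ p {z z′} → p ≤ z → p ≤ z′ → z < p + n → z′ < p + n → vtx z ≡ vtx z′ → z ≡ z′
  vtx-injective-window p {z} {z′} p≤z p≤z′ z<p+n z′<p+n e with <-cmp z z′
  ... | tri≈ _ z≡z′ _ = z≡z′
  ... | tri< z<z′ _ _ = ⊥-elim (vtx-+≢ z (m<n⇒0<n∸m z<z′) (≤-<-trans (∸-monoʳ-≤ z′ p≤z) (m<n+o⇒m∸n<o z′ p z′<p+n))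
                          (trans (cong vtx (m+[n∸m]≡n (<⇒≤ z<z′))) (sym e)))
  ... | tri> _ _ z′<z = ⊥-elim (vtx-+≢ z′ (m<n⇒0<n∸m z′<z) (≤-<-trans (∸-monoʳ-≤ z p≤z′) (m<n+o⇒m∸n<o z p z<p+n))
                          (trans (cong vtx (m+[n∸m]≡n (<⇒≤ z′<z))) e))

  vtx-surjective-window : ∀ p x → Σ ℕ (λ z → p ≤ z × z < p + n × vtx z ≡ x)
  vtx-surjective-window zero x = toℕ x , z≤n , Fin.toℕ<n x , vtx-toℕ x
  vtx-surjective-window (suc p) x with vtx-surjective-window p x
  ... | z , p≤z , z<p+n , e with m≤n⇒m<n∨m≡n p≤z
  ...   | inj₁ p<z = z , p<z , m<n⇒m<1+n z<p+n , e
  ...   | inj₂ refl = n + p , +-monoˡ-≤ p (s≤s z≤n) ,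
                      subst (n + p <_) (+-comm n (suc p)) (+-monoʳ-< n (n<1+n p)) , trans (vtx-n+ p) e

  next≢id : ∀ x → next x ≢ x
  next≢id x e = vtx-+≢ (toℕ x) {1} (s≤s z≤n) (s≤s (s≤s z≤n))
    (trans (cong vtx (+-comm (toℕ x) 1)) (trans (cong next (vtx-toℕ x)) (trans e (sym (vtx-toℕ x)))))

  next²≢id : ∀ x → next (next x) ≢ x
  next²≢id x e = vtx-+≢ (toℕ x) {2} (s≤s z≤n) (s≤s (s≤s (s≤s z≤n)))
    (trans (cong vtx (+-comm (toℕ x) 2)) (trans (cong (λ y → next (next y)) (vtx-toℕ x)) (trans e (sym (vtx-toℕ x)))))

  G : Graph n
  G = Cycle m

  Adj⇒next : ∀ {x y} → Adj G x y → next x ≡ y ⊎ next y ≡ x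
  Adj⇒next {x} {y} (inj₁ e) with toℕ-next x
  ... | inj₁ (a , _) = inj₁ (Fin.toℕ-injective (trans a (sym e)))
  ... | inj₂ (_ , b) = ⊥-elim (<-irrefl (trans e b) (Fin.toℕ<n y))
  Adj⇒next {x} {y} (inj₂ (inj₁ e)) with toℕ-next y
  ... | inj₁ (a , _) = inj₂ (Fin.toℕ-injective (trans a (sym e)))
  ... | inj₂ (_ , b) = ⊥-elim (<-irrefl (trans e b) (Fin.toℕ<n x))
  Adj⇒next {x} {y} (inj₂ (inj₂ (inj₁ (a , b)))) with toℕ-next y
  ... | inj₁ (_ , lt) = ⊥-elim (<-irrefl b lt)
  ... | inj₂ (c , _) = inj₂ (Fin.toℕ-injective (trans c (sym a)))
  Adj⇒next {x} {y} (inj₂ (inj₂ (inj₂ (a , b)))) with toℕ-next x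
  ... | inj₁ (_ , lt) = ⊥-elim (<-irrefl b lt)
  ... | inj₂ (c , _) = inj₁ (Fin.toℕ-injective (trans c (sym a)))

  next⇒Adj : ∀ {x y} → next x ≡ y → Adj G x y
  next⇒Adj {x} refl with toℕ-next x
  ... | inj₁ (a , _) = inj₁ a
  ... | inj₂ (a , b) = inj₂ (inj₂ (inj₂ (a , b)))

module EdgeCounting (m : ℕ) where
  open Positions m

  edgeCount≡∑ : (H : Subgraph G) → edgeCount H ≡ sum (λ x → 𝟙 (E H x (next x)))
  edgeCount≡∑ H = begin
    edgeCount H                                              ≡⟨ listSum-allFin n (λ i → ListAction.sum (map (g i) (allFin n))) ⟩
    sum (λ i → ListAction.sum (map (g i) (allFin n)))         ≡⟨ sum-cong-≗ (λ i → listSum-allFin n (g i)) ⟩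
    sum (λ i → sum (g i))                                    ≡⟨ sum-cong-≗ (λ i → sum-cong-≗ (split i)) ⟩
    sum (λ i → sum (λ j → forward i j + backward i j))       ≡⟨ sum-cong-≗ (λ i → ∑-distrib-+ (forward i) (backward i)) ⟩
    sum (λ i → sum (forward i) + sum (backward i))           ≡⟨ ∑-distrib-+ (λ i → sum (forward i)) (λ i → sum (backward i)) ⟩
    sum (λ i → sum (forward i)) + sum (λ i → sum (backward i)) ≡⟨ cong₂ _+_ (sum-cong-≗ forward-row) (trans (∑-comm backward) (sum-cong-≗ backward-column)) ⟩
    sum (λ x → g x (next x)) + sum (λ x → g (next x) x)      ≡⟨ ∑-distrib-+ (λ x → g x (next x)) (λ x → g (next x) x) ⟨
    sum (λ x → g x (next x) + g (next x) x)                  ≡⟨ sum-cong-≗ both-orientations ⟩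
    sum (λ x → 𝟙 (E H x (next x)))                          ∎
    where
    open ≡-Reasoning
    g : Fin n → Fin n → ℕ
    g i j = 𝟙 ((toℕ i <ᵇ toℕ j) ∧ E H i j)

    forward backward : Fin n → Fin n → ℕ
    forward i j = if next i == j then g i j else 0
    backward i j = if next j == i then g i j else 0

    split : ∀ i j → g i j ≡ forward i j + backward i j
    split i j with E H i j in e
    ... | false rewrite ∧-zeroʳ (toℕ i <ᵇ toℕ j) = sym (cong₂ _+_ (if-0 (next i == j)) (if-0 (next j == i)))
      where
      if-0 : ∀ b → (if b then 0 else 0) ≡ 0
      if-0 true = refl
      if-0 false = refl
    ... | true with Adj⇒next (E-adj H i j e)
    ...   | inj₁ refl rewrite ==-refl (next i) | ≢⇒==≡false (next²≢id i) = sym (+-identityʳ _)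
    ...   | inj₂ refl rewrite ==-refl (next j) | ≢⇒==≡false (next²≢id j) = refl

    forward-row : ∀ i → sum (forward i) ≡ g i (next i)
    forward-row i = trans (∑-point (forward i) (next i) (λ j j≢ → cong (λ b → if b then g i j else 0) (≢⇒==≡false (j≢ ∘ sym))))
                          (cong (λ b → if b then g i (next i) else 0) (==-refl (next i)))

    backward-column : ∀ j → sum (λ i → backward i j) ≡ g (next j) j
    backward-column j = trans (∑-point (λ i → backward i j) (next j) (λ i i≢ → cong (λ b → if b then g i j else 0) (≢⇒==≡false (i≢ ∘ sym))))
                              (cong (λ b → if b then g (next j) j else 0) (==-refl (next j)))

    both-orientations : ∀ x → g x (next x) + g (next x) x ≡ 𝟙 (E H x (next x))
    both-orientations x rewrite E-sym H (next x) x with E H x (next x)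
    ... | false rewrite ∧-zeroʳ (toℕ x <ᵇ toℕ (next x)) | ∧-zeroʳ (toℕ (next x) <ᵇ toℕ x) = refl
    ... | true with <-cmp (toℕ x) (toℕ (next x))
    ...   | tri< x<y _ y≮x rewrite m<n⇒m<ᵇn≡true x<y | n≤m⇒m<ᵇn≡false (≮⇒≥ y≮x) = refl
    ...   | tri≈ _ x≡y _ = ⊥-elim (next≢id x (sym (Fin.toℕ-injective x≡y)))
    ...   | tri> x≮y _ y<x rewrite m<n⇒m<ᵇn≡true y<x | n≤m⇒m<ᵇn≡false (≮⇒≥ x≮y) = refl

module Arcs (m : ℕ) where
  open Positions m
  open EdgeCounting m

  arc : ℕ → ℕ → Fin n → Bool
  arc p zero x = false
  arc p (suc L) x = arc p L x ∨ (vtx (p + L) == x)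

  arc⇒position : ∀ p L {x} → arc p L x ≡ true → Σ ℕ (λ z → p ≤ z × z < p + L × vtx z ≡ x)
  arc⇒position p (suc L) {x} e with arc p L x in e′
  ... | true with arc⇒position p L e′
  ...   | z , p≤z , z<p+L , vz = z , p≤z , ≤-trans z<p+L (+-monoʳ-≤ p (n≤1+n L)) , vz
  arc⇒position p (suc L) e | false = p + L , m≤m+n p L , +-monoʳ-< p (n<1+n L) , ==≡true⇒≡ e

  position⇒arc : ∀ p L {z x} → p ≤ z → z < p + L → vtx z ≡ x → arc p L x ≡ true
  position⇒arc p zero {z} p≤z z<p+0 _ = ⊥-elim (<-irrefl refl (<-≤-trans z<p+0 (subst (_≤ z) (sym (+-identityʳ p)) p≤z)))
  position⇒arc p (suc L) {z} {x} p≤z z<p+sL e with m≤n⇒m<n∨m≡n (s≤s⁻¹ (subst (z <_) (+-suc p L) z<p+sL))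
  ... | inj₁ z<p+L rewrite position⇒arc p L p≤z z<p+L e = refl
  ... | inj₂ refl rewrite e | ==-refl x = ∨-zeroʳ (arc p L x)

  arc-cong : ∀ {p p′} → vtx p ≡ vtx p′ → ∀ L x → arc p L x ≡ arc p′ L x
  arc-cong e zero x = refl
  arc-cong {p} {p′} e (suc L) x rewrite arc-cong {p} {p′} e L x | vtx-+ {p} {p′} L e = refl

  ∑𝟙arc : ∀ p L → L ≤ n → sum (λ x → 𝟙 (arc p L x)) ≡ L
  ∑𝟙arc p zero _ = ∑-zero {f = λ x → 𝟙 (arc p 0 x)} (λ _ → refl)
  ∑𝟙arc p (suc L) sL≤n = begin
    sum (λ x → 𝟙 (arc p L x ∨ (vtx (p + L) == x)))                ≡⟨ sum-cong-≗ split ⟩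
    sum (λ x → 𝟙 (arc p L x) + 𝟙 (x == vtx (p + L)))              ≡⟨ ∑-distrib-+ (λ x → 𝟙 (arc p L x)) (λ x → 𝟙 (x == vtx (p + L))) ⟩
    sum (λ x → 𝟙 (arc p L x)) + sum (λ x → 𝟙 (x == vtx (p + L))) ≡⟨ cong₂ _+_ (∑𝟙arc p L (<⇒≤ sL≤n)) (∑𝟙[x==a]≡1 (vtx (p + L))) ⟩
    L + 1                                                        ≡⟨ +-comm L 1 ⟩
    suc L                                                        ∎
    where
    open ≡-Reasoning
    new : ∀ x → arc p L x ≡ true → vtx (p + L) ≢ x
    new x e refl with arc⇒position p L e
    ... | z , p≤z , z<p+L , vz = <-irrefl (vtx-injective-window p p≤z (m≤m+n p L)
                                   (<-≤-trans z<p+L (+-monoʳ-≤ p (<⇒≤ sL≤n))) (+-monoʳ-< p sL≤n) vz) z<p+L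
    split : ∀ x → 𝟙 (arc p L x ∨ (vtx (p + L) == x)) ≡ 𝟙 (arc p L x) + 𝟙 (x == vtx (p + L))
    split x with arc p L x in e | x Fin.≟ vtx (p + L)
    ... | false | yes refl rewrite ==-refl x = refl
    ... | false | no x≢ rewrite ≢⇒==≡false (x≢ ∘ sym) = refl
    ... | true | yes refl = ⊥-elim (new x e refl)
    ... | true | no _ = refl

  distance<n : ∀ {p L a b} → L ≤ n → p ≤ a → a ≤ b → b < p + L → b ∸ a < n
  distance<n {p} {L} {a} {b} L≤n p≤a a≤b b<p+L =
    <-≤-trans (≤-<-trans (∸-monoʳ-≤ b p≤a) (n≤m<n+o⇒m∸n<o (≤-trans p≤a a≤b) b<p+L)) L≤n

  arc-interval : ∀ p L {a za zb} → p ≤ za → za ≤ zb → zb < p + L → vtx za ≡ vtx a →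
    ∀ {z} → a ≤ z → z ≤ a + (zb ∸ za) → arc p L (vtx z) ≡ true
  arc-interval p L {a} {za} {zb} p≤za za≤zb zb<p+L va {z} a≤z z≤end =
    position⇒arc p L (≤-trans p≤za (m≤m+n za (z ∸ a))) (≤-<-trans within zb<p+L)
      (trans (vtx-+ {za} {a} (z ∸ a) va) (cong vtx (m+[n∸m]≡n a≤z)))
    where
    within : za + (z ∸ a) ≤ zb
    within = begin
      za + (z ∸ a)         ≤⟨ +-monoʳ-≤ za (∸-monoˡ-≤ a z≤end) ⟩
      za + (a + (zb ∸ za) ∸ a) ≡⟨ cong (za +_) (m+n∸m≡n a (zb ∸ za)) ⟩
      za + (zb ∸ za)       ≡⟨ m+[n∸m]≡n za≤zb ⟩
      zb                   ∎
      where open ≤-Reasoning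

  arc-between : ∀ p L → L ≤ n → ∀ {x y} → x < y → y < x + n → arc p L (vtx x) ≡ true → arc p L (vtx y) ≡ true →
    (∀ {z} → x ≤ z → z ≤ y → arc p L (vtx z) ≡ true) ⊎ (∀ {z} → y ≤ z → z ≤ x + n → arc p L (vtx z) ≡ true)
  arc-between p L L≤n {x} {y} x<y y<x+n ex ey with arc⇒position p L ex | arc⇒position p L ey
  ... | zx , p≤zx , zx<p+L , vzx | zy , p≤zy , zy<p+L , vzy with ≤-total zx zy
  ...   | inj₁ zx≤zy = inj₁ (λ {z} x≤z z≤y → arc-interval p L p≤zx zx≤zy zy<p+L vzx x≤z (subst (z ≤_) (sym x+d≡y) z≤y))
    where
    x+d≡y : x + (zy ∸ zx) ≡ y
    x+d≡y = vtx-injective-window x (m≤m+n x _) (<⇒≤ x<y) (+-monoʳ-< x (distance<n L≤n p≤zx zx≤zy zy<p+L)) y<x+n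
              (trans (sym (vtx-+ {zx} {x} (zy ∸ zx) vzx)) (trans (cong vtx (m+[n∸m]≡n zx≤zy)) vzy))
  ...   | inj₂ zy≤zx = inj₂ (λ {z} y≤z z≤x+n → arc-interval p L p≤zy zy≤zx zx<p+L vzy y≤z (subst (z ≤_) (sym y+d≡x+n) z≤x+n))
    where
    y+d≡x+n : y + (zx ∸ zy) ≡ x + n
    y+d≡x+n = vtx-injective-window y (m≤m+n y _) (<⇒≤ y<x+n) (+-monoʳ-< y (distance<n L≤n p≤zy zy≤zx zx<p+L))
                (+-monoˡ-< n x<y)
                (trans (sym (vtx-+ {zy} {y} (zx ∸ zy) vzy))
                  (trans (cong vtx (m+[n∸m]≡n zy≤zx)) (trans vzx (trans (sym (vtx-n+ x)) (cong vtx (+-comm n x))))))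

  -- The cycle with the L + 1 edges x — next x, x ∈ cut, deleted: a path on the vertices
  -- at positions p + L + 1, …, p + n.
  module CutPath (p L : ℕ) (sL≤n : suc L ≤ n) where
    cut interior : Fin n → Bool
    cut = arc p (suc L)
    interior = arc (suc p) L

    pathV : Subset n
    pathV = tabulate (not ∘ interior)

    pathE : Fin n → Fin n → Bool
    pathE x y = (next x == y ∧ not (cut x)) ∨ (next y == x ∧ not (cut y))

    ∈pathV : ∀ {x} → interior x ≡ false → x ∈ pathV
    ∈pathV {x} e = lookup⇒[]= x pathV (trans (lookup∘tabulate (not ∘ interior) x) (cong not e))

    ∈pathV⁻ : ∀ {x} → x ∈ pathV → interior x ≡ false
    ∈pathV⁻ {x} x∈ = not-injective (trans (sym (lookup∘tabulate (not ∘ interior) x)) ([]=⇒lookup x∈))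

    interior⇒cut : ∀ {x} → interior x ≡ true → cut x ≡ true
    interior⇒cut e with arc⇒position (suc p) L e
    ... | z , sp≤z , z<sp+L , vz = position⇒arc p (suc L) (<⇒≤ sp≤z) (subst (z <_) (sym (+-suc p L)) z<sp+L) vz

    interior∘next⇒cut : ∀ {y} → interior (next y) ≡ true → cut y ≡ true
    interior∘next⇒cut {y} e with arc⇒position (suc p) L e
    ... | suc z , sp≤sz , sz<sp+L , vz =
      position⇒arc p (suc L) (s≤s⁻¹ sp≤sz) (<-trans (s≤s⁻¹ sz<sp+L) (subst (p + L <_) (sym (+-suc p L)) ≤-refl)) (next-injective vz)

    pathE-adj : ∀ x y → pathE x y ≡ true → Adj G x y
    pathE-adj x y e with ∨≡true {next x == y ∧ not (cut x)} e
    ... | inj₁ e₁ = next⇒Adj (==≡true⇒≡ (proj₁ (∧≡true e₁)))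
    ... | inj₂ e₂ = Adj-sym G (next⇒Adj (==≡true⇒≡ (proj₁ (∧≡true e₂))))

    pathE-V : ∀ x y → pathE x y ≡ true → x ∈ pathV
    pathE-V x y e with interior x in ix
    ... | false = ∈pathV ix
    ... | true with ∨≡true {next x == y ∧ not (cut x)} e
    ...   | inj₁ e₁ = ⊥-elim (false≢true (trans (sym (cong not (interior⇒cut ix))) (proj₂ (∧≡true e₁))))
    ...   | inj₂ e₂ with ∧≡true e₂
    ...     | ey , ¬cy = ⊥-elim (false≢true (trans (sym (cong not cy)) ¬cy))
      where
      cy : cut y ≡ true
      cy = interior∘next⇒cut (subst (λ u → interior u ≡ true) (sym (==≡true⇒≡ ey)) ix)

    path : Subgraph G
    path = record
      { V = pathV
      ; E = pathE
      ; E-sym = λ x y → ∨-comm (next x == y ∧ not (cut x)) _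
      ; E-adj = pathE-adj
      ; E-V = pathE-V
      }

    edgeCount-path : edgeCount path + suc L ≡ n
    edgeCount-path = begin
      edgeCount path + suc L                                   ≡⟨ cong₂ _+_ (edgeCount≡∑ path) (sym (∑𝟙arc p (suc L) sL≤n)) ⟩
      sum (λ x → 𝟙 (pathE x (next x))) + sum (λ x → 𝟙 (cut x)) ≡⟨ cong (_+ sum (λ x → 𝟙 (cut x))) (sum-cong-≗ forward-only) ⟩
      sum (λ x → 𝟙 (not (cut x))) + sum (λ x → 𝟙 (cut x))     ≡⟨ +-comm (sum (λ x → 𝟙 (not (cut x)))) _ ⟩
      sum (λ x → 𝟙 (cut x)) + sum (λ x → 𝟙 (not (cut x)))     ≡⟨ ∑𝟙+∑𝟙∘not cut ⟩
      n                                                        ∎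
      where
      open ≡-Reasoning
      forward-only : ∀ x → 𝟙 (pathE x (next x)) ≡ 𝟙 (not (cut x))
      forward-only x rewrite ==-refl (next x) | ≢⇒==≡false (next²≢id x) = cong 𝟙 (∨-identityʳ (not (cut x)))

    cut-vtx≡false : ∀ {z} → p + suc L ≤ z → z < p + n → cut (vtx z) ≡ false
    cut-vtx≡false {z} p+sL≤z z<p+n with cut (vtx z) in e
    ... | false = refl
    ... | true with arc⇒position p (suc L) e
    ...   | z′ , p≤z′ , z′<p+sL , vz′ = ⊥-elim (<-irrefl (vtx-injective-window p p≤z′ (≤-trans (m≤m+n p (suc L)) p+sL≤z)
                                          (<-≤-trans z′<p+sL (+-monoʳ-≤ p sL≤n)) z<p+n vz′) (<-≤-trans z′<p+sL p+sL≤z))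

    walk-forward : ∀ d {z} → p + suc L ≤ z → z + d ≤ p + n → Walk path (vtx z) (vtx (z + d))
    walk-forward zero {z} _ _ rewrite +-identityʳ z = here
    walk-forward (suc d) {z} p+sL≤z z+sd≤p+n rewrite +-suc z d = step edge (walk-forward d (m≤n⇒m≤1+n p+sL≤z) z+sd≤p+n)
      where
      edge : pathE (vtx z) (vtx (suc z)) ≡ true
      edge rewrite ==-refl (next (vtx z)) | cut-vtx≡false p+sL≤z (<-≤-trans (s≤s (m≤m+n z d)) z+sd≤p+n) = refl

    path-position : ∀ {x} → x ∈ pathV → Σ ℕ (λ z → p + suc L ≤ z × z ≤ p + n × vtx z ≡ x)
    path-position {x} x∈ with vtx-surjective-window (suc p) x
    ... | z , sp≤z , z<sp+n , vz with p + suc L ≤? z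
    ...   | yes p+sL≤z = z , p+sL≤z , s≤s⁻¹ z<sp+n , vz
    ...   | no z<p+sL = ⊥-elim (false≢true (trans (sym (∈pathV⁻ x∈))
                             (position⇒arc (suc p) L sp≤z (subst (z <_) (+-suc p L) (≰⇒> z<p+sL)) vz)))

    path-connected : Connected path
    path-connected x y x∈ y∈ with path-position x∈ | path-position y∈
    ... | zx , lx , ux , vx | zy , ly , uy , vy with ≤-total zx zy
    ...   | inj₁ zx≤zy = subst₂ (Walk path) vx (trans (cong vtx (m+[n∸m]≡n zx≤zy)) vy)
                           (walk-forward (zy ∸ zx) lx (subst (_≤ p + n) (sym (m+[n∸m]≡n zx≤zy)) uy))
    ...   | inj₂ zy≤zx = subst₂ (Walk path) (trans (cong vtx (m+[n∸m]≡n zy≤zx)) vx) vy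
                           (reverseʷ (walk-forward (zx ∸ zy) ly (subst (_≤ p + n) (sym (m+[n∸m]≡n zy≤zx)) ux)))

module Gaps (m : ℕ) where
  open Positions m
  open EdgeCounting m
  open Arcs m

  -- The k vertices at positions p + 1, …, p + k avoid S, so the k + 1 edges at positions
  -- p, …, p + k form a gap of S.
  Gap : Subset n → ℕ → ℕ → Set
  Gap S p k = ∀ x → x ∈ S → arc (suc p) k x ≡ false

  module _ (H : Subgraph G) where
    Missing : Fin n → Set
    Missing x = E H x (next x) ≡ false

    walk-trapped : ∀ {a b} → Missing (vtx a) → Missing (vtx b) → ∀ {x y} → Walk H x y →
      Σ ℕ (λ z → a < z × z ≤ b × vtx z ≡ x) → Σ ℕ (λ z → a < z × z ≤ b × vtx z ≡ y)
    walk-trapped ma mb here inside = inside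
    walk-trapped {a} {b} ma mb {x} (step {y = y} e w) (z , a<z , z≤b , vz) = walk-trapped ma mb w (stepped (Adj⇒next (E-adj H x y e)))
      where
      stepped : next x ≡ y ⊎ next y ≡ x → Σ ℕ (λ z → a < z × z ≤ b × vtx z ≡ y)
      stepped (inj₁ refl) with m≤n⇒m<n∨m≡n z≤b
      ... | inj₁ z<b = suc z , <-trans a<z (n<1+n z) , z<b , cong next vz
      ... | inj₂ refl = ⊥-elim (false≢true (trans (sym mb) (trans (cong (λ u → E H u (next u)) vz) e)))
      stepped (inj₂ refl) = back z a<z z≤b vz
        where
        back : ∀ z → a < z → z ≤ b → vtx z ≡ next y → Σ ℕ (λ z → a < z × z ≤ b × vtx z ≡ y)
        back (suc z′) sa≤sz′ sz′≤b vsz′ with m≤n⇒m<n∨m≡n (s≤s⁻¹ sa≤sz′)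
        ... | inj₁ a<z′ = z′ , a<z′ , <⇒≤ sz′≤b , next-injective vsz′
        ... | inj₂ refl = ⊥-elim (false≢true (trans (sym ma) (trans (cong (λ u → E H u (next u)) (next-injective vsz′))
                             (trans (E-sym H y x) e))))

    edgeCount-≥ : ∀ p L → L ≤ n → (∀ x → Missing x → arc p L x ≡ true) → n ≤ edgeCount H + L
    edgeCount-≥ p L L≤n covered = begin
      n                                                                ≡⟨ ∑𝟙+∑𝟙∘not (λ x → E H x (next x)) ⟨
      sum (λ x → 𝟙 (E H x (next x))) + sum (λ x → 𝟙 (not (E H x (next x)))) ≤⟨ +-mono-≤ (≤-reflexive (sym (edgeCount≡∑ H))) (∑-mono-≤ missing≤arc) ⟩
      edgeCount H + sum (λ x → 𝟙 (arc p L x))                          ≡⟨ cong (edgeCount H +_) (∑𝟙arc p L L≤n) ⟩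
      edgeCount H + L                                                  ∎
      where
      open ≤-Reasoning
      missing≤arc : ∀ x → 𝟙 (not (E H x (next x))) ≤ 𝟙 (arc p L x)
      missing≤arc x with E H x (next x) in e
      ... | true = z≤n
      ... | false rewrite covered x e = ≤-refl

    module _ (conn : Connected H) (S : Subset n) (S⊆V : S ⊆ V H) {s₀ : Fin n} (s₀∈S : s₀ ∈ S) where
      private
        s = toℕ s₀

      offset : ∀ x → Σ ℕ (λ t → t < n × vtx (s + t) ≡ x)
      offset x with vtx-surjective-window s x
      ... | z , s≤z , z<s+n , vz = z ∸ s , m<n+o⇒m∸n<o z s z<s+n , trans (cong vtx (m+[n∸m]≡n s≤z)) vz

      -- A vertex of S strictly between the first and the last missing edge could not reach s₀.
      missing-edges-between : ∀ {i j} → i ≤ j → j < n → Missing (vtx (s + i)) → Missing (vtx (s + j)) →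
        (∀ t → t < n → Missing (vtx (s + t)) → i ≤ t × t ≤ j) →
        (∀ x → Missing x → arc (s + i) (suc (j ∸ i)) x ≡ true) × Gap S (s + i) (j ∸ i)
      missing-edges-between {i} {j} i≤j j<n mi mj extreme = covered , gap
        where
        end : s + i + suc (j ∸ i) ≡ suc (s + j)
        end = trans (+-suc (s + i) (j ∸ i)) (cong suc (trans (+-assoc s i (j ∸ i)) (cong (s +_) (m+[n∸m]≡n i≤j))))
        covered : ∀ x → Missing x → arc (s + i) (suc (j ∸ i)) x ≡ true
        covered x mx with offset x
        ... | t , t<n , vt with extreme t t<n (subst Missing (sym vt) mx)
        ...   | i≤t , t≤j = position⇒arc (s + i) (suc (j ∸ i)) (+-monoʳ-≤ s i≤t) (subst (s + t <_) (sym end) (s≤s (+-monoʳ-≤ s t≤j))) vt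
        gap : Gap S (s + i) (j ∸ i)
        gap x x∈S with arc (suc (s + i)) (j ∸ i) x in e
        ... | false = refl
        ... | true with arc⇒position (suc (s + i)) (j ∸ i) e
        ...   | z , si<z , z<si+k , vz with walk-trapped mi mj (conn x s₀ (S⊆V x∈S) (S⊆V s₀∈S))
                                              (z , si<z , s≤s⁻¹ (subst (z <_) (trans (sym (+-suc (s + i) (j ∸ i))) end) z<si+k) , vz)
        ...     | y , si<y , y≤sj , vy = ⊥-elim (<-irrefl (vtx-injective-window s ≤-refl (≤-trans (m≤m+n s i) (<⇒≤ si<y))
                                            (m<m+n s (s≤s z≤n)) (≤-<-trans y≤sj (+-monoʳ-< s j<n)) (trans (vtx-toℕ s₀) (sym vy)))
                                            (≤-<-trans (m≤m+n s i) si<y))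

      Missing? : ∀ t → Dec (Missing (vtx (s + t)))
      Missing? t = E H (vtx (s + t)) (vtx (suc (s + t))) Bool.≟ false

      missing-span : ∀ {t₀} → t₀ < n → Missing (vtx (s + t₀)) → Σ ℕ λ i → Σ ℕ λ j → i ≤ j × j < n ×
        Missing (vtx (s + i)) × Missing (vtx (s + j)) × (∀ t → t < n → Missing (vtx (s + t)) → i ≤ t × t ≤ j)
      missing-span {t₀} t₀<n mt₀ = i , j , i≤j , j<n , mi , mj , extreme
        where
        first = least (λ t → Missing (vtx (s + t))) Missing? t₀ mt₀
        last = greatest (λ t → t < n × Missing (vtx (s + t))) (λ t → (t <? n) ×-dec Missing? t) n t₀ (t₀<n , mt₀) (λ _ q → <⇒≤ (proj₁ q))
        i = proj₁ first
        j = proj₁ last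
        mi : Missing (vtx (s + i))
        mi = proj₁ (proj₂ first)
        j<n : j < n
        j<n = proj₁ (proj₁ (proj₂ last))
        mj : Missing (vtx (s + j))
        mj = proj₂ (proj₁ (proj₂ last))
        i≤j : i ≤ j
        i≤j = proj₂ (proj₂ last) i (≤-<-trans (proj₁ (proj₂ (proj₂ first))) t₀<n , mi)
        extreme : ∀ t → t < n → Missing (vtx (s + t)) → i ≤ t × t ≤ j
        extreme t t<n mt = ≮⇒≥ (λ t<i → proj₂ (proj₂ (proj₂ first)) t t<i mt) , proj₂ (proj₂ last) t (t<n , mt)

      missing-edges-in-gap : Σ ℕ λ p → Σ ℕ λ k → suc k ≤ n × (∀ x → Missing x → arc p (suc k) x ≡ true) × Gap S p k
      missing-edges-in-gap with Fin.any? (λ t → Missing? (toℕ t))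
      ... | no none = s , 0 , s≤s z≤n , (λ x mx → ⊥-elim (none (at x mx))) , (λ _ _ → refl)
        where
        at : ∀ x → Missing x → Σ (Fin n) (λ t → Missing (vtx (s + toℕ t)))
        at x mx with offset x
        ... | t , t<n , vt = fromℕ< t<n , subst Missing (sym (trans (cong (λ u → vtx (s + u)) (Fin.toℕ-fromℕ< t<n)) vt)) mx
      ... | yes (t₀ , mt₀) with missing-span (Fin.toℕ<n t₀) mt₀
      ...   | i , j , i≤j , j<n , mi , mj , extreme =
        s + i , j ∸ i , ≤-<-trans (m∸n≤m j i) j<n , missing-edges-between i≤j j<n mi mj extreme

  edgeCount-connected-≥ : ∀ (H : Subgraph G) → Connected H → ∀ S → S ⊆ V H → ∀ {s₀} → s₀ ∈ S →
    Σ ℕ λ p → Σ ℕ λ k → suc k ≤ n × Gap S p k × n ≤ edgeCount H + suc k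
  edgeCount-connected-≥ H conn S S⊆V s₀∈S with missing-edges-in-gap H conn S S⊆V s₀∈S
  ... | p , k , sk≤n , covered , gap = p , k , sk≤n , gap , edgeCount-≥ H p (suc k) sk≤n covered

  Gap? : ∀ S p k → Dec (Gap S p k)
  Gap? S p k = Fin.all? (λ x → (x ∈? S) →-dec (arc (suc p) k x Bool.≟ false))

  Gap-cong : ∀ {S p p′ k} → vtx p ≡ vtx p′ → Gap S p k → Gap S p′ k
  Gap-cong {p = p} {p′} {k} e gap x x∈S = trans (sym (arc-cong {suc p} {suc p′} (cong next e) k x)) (gap x x∈S)

  gap-through-neighbours : ∀ {S p k c} → Gap S p k → vtx c ∈ S → vtx (2 + c) ∈ S → arc (suc p) k (vtx (suc c)) ≡ true → k ≤ 1
  gap-through-neighbours {S} {p} {k} {c} gap c∈S c+2∈S e = at (arc⇒position (suc p) k e)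
    where
    avoided : ∀ {z} → vtx z ∈ S → arc (suc p) k (vtx z) ≡ true → ⊥
    avoided z∈S e′ = false≢true (trans (sym (gap _ z∈S)) e′)
    at-end : ∀ z → suc p ≤ z → z < suc p + k → suc p + k ≤ suc z → vtx z ≡ vtx (suc c) → 1 < k → ⊥
    at-end (suc z′) _ sz′<sp+k sp+k≤ssz′ vsz′ 2≤k =
      avoided {c} c∈S (position⇒arc (suc p) k sp≤z′ (<-trans (n<1+n z′) sz′<sp+k) (next-injective vsz′))
      where
      sp≤z′ : suc p ≤ z′
      sp≤z′ = s≤s⁻¹ (s≤s⁻¹ (≤-trans (subst (_≤ suc p + k) (+-comm (suc p) 2) (+-monoʳ-≤ (suc p) 2≤k)) sp+k≤ssz′))

    at : Σ ℕ (λ z → suc p ≤ z × z < suc p + k × vtx z ≡ vtx (suc c)) → k ≤ 1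
    at (z , sp≤z , z<sp+k , vz) with suc z <? suc p + k
    ... | yes sz<sp+k = ⊥-elim (avoided {2 + c} c+2∈S (position⇒arc (suc p) k (≤-trans sp≤z (n≤1+n z)) sz<sp+k (cong next vz)))
    ... | no sz≮sp+k = ≮⇒≥ {1} {k} (at-end z sp≤z z<sp+k (≮⇒≥ sz≮sp+k) vz)

  record LongestGap (S : Subset n) : Set where
    field
      start inner : ℕ
      fits : suc inner ≤ n
      gap : Gap S start inner
      longest : ∀ q k → suc k ≤ n → Gap S q k → k ≤ inner

  module _ (S : Subset n) where
    private
      Realised : ℕ → Set
      Realised k = suc k ≤ n × Σ (Fin n) (λ q → Gap S (toℕ q) k)

      realised : ∀ {q k} → suc k ≤ n → Gap S q k → Realised k
      realised {q} {k} sk≤n gap = sk≤n , vtx q , Gap-cong {S} {q} {toℕ (vtx q)} {k} (sym (vtx-toℕ (vtx q))) gap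

      toLongestGap : Σ ℕ (λ k → Realised k × (∀ k′ → Realised k′ → k′ ≤ k)) → LongestGap S
      toLongestGap (k , (sk≤n , q , gap) , greatest-k) = record
        { start = toℕ q ; inner = k ; fits = sk≤n ; gap = gap
        ; longest = λ q′ k′ sk′≤n gap′ → greatest-k k′ (realised sk′≤n gap′) }

    -- Opaque, so that type checking never unfolds the search.
    opaque
      longestGap : ∀ {q₀ k₀} → suc k₀ ≤ n → Gap S q₀ k₀ → Σ (LongestGap S) (λ g → k₀ ≤ LongestGap.inner g)
      longestGap {q₀} {k₀} fits₀ gap₀ = toLongestGap best , proj₂ (proj₂ best) k₀ (realised fits₀ gap₀)
        where
        best : Σ ℕ (λ k → Realised k × (∀ k′ → Realised k′ → k′ ≤ k))
        best = greatest Realised (λ k → (suc k ≤? n) ×-dec Fin.any? (λ q → Gap? S (toℕ q) k)) n k₀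
                 (realised fits₀ gap₀) (λ _ r → <⇒≤ (proj₁ r))

  Gap⇒⊆pathV : ∀ {S p k} (sk≤n : suc k ≤ n) → Gap S p k → S ⊆ CutPath.pathV p k sk≤n
  Gap⇒⊆pathV {p = p} {k} sk≤n gap {x} x∈S = CutPath.∈pathV p k sk≤n (gap x x∈S)

  cutPath-steinerTree : ∀ {B} (g : LongestGap B) → ∀ {b₀} → b₀ ∈ B →
    SteinerTree G B (CutPath.path (LongestGap.start g) (LongestGap.inner g) (LongestGap.fits g))
  cutPath-steinerTree {B} g b₀∈B = (path-connected , Gap⇒⊆pathV fits gap) , minimal
    where
    open LongestGap g
    open CutPath start inner fits
    minimal : ∀ H → ConnContaining G B H → edgeCount path ≤ edgeCount H
    minimal H (conn , B⊆V) = via (edgeCount-connected-≥ H conn B B⊆V b₀∈B)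
      where
      via : (Σ ℕ λ q → Σ ℕ λ k → suc k ≤ n × Gap B q k × n ≤ edgeCount H + suc k) → edgeCount path ≤ edgeCount H
      via (q , k , sk≤n , gap′ , n≤eH+sk) = +-cancelʳ-≤ (suc inner) (edgeCount path) (edgeCount H) (begin
        edgeCount path + suc inner ≡⟨ edgeCount-path ⟩
        n                          ≤⟨ n≤eH+sk ⟩
        edgeCount H + suc k        ≤⟨ +-monoʳ-≤ (edgeCount H) (s≤s (longest q k sk≤n gap′)) ⟩
        edgeCount H + suc inner    ∎)
        where open ≤-Reasoning

module Counting (m : ℕ) where
  open Positions m

  rank : Subset n → ℕ → ℕ
  rank A t = sum< t (λ z → 𝟙 (lookup A (vtx z)))

  rank-n : ∀ A → rank A n ≡ ∣ A ∣
  rank-n A = sym (begin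
    ∣ A ∣                               ≡⟨ ∣p∣≡∑𝟙 A ⟩
    sum {n} (λ x → 𝟙 (lookup A x))      ≡⟨ sum-cong-≗ {n} (λ x → cong (λ v → 𝟙 (lookup A v)) (sym (vtx-toℕ x))) ⟩
    sum {n} (λ x → 𝟙 (lookup A (vtx (toℕ x)))) ≡⟨ ∑∘toℕ≡sum< n (λ z → 𝟙 (lookup A (vtx z))) ⟩
    rank A n                            ∎)
    where open ≡-Reasoning

  rank-mono : ∀ A {t t′} → t ≤ t′ → rank A t ≤ rank A t′
  rank-mono A {t} {zero} t≤0 rewrite n≤0⇒n≡0 t≤0 = ≤-refl
  rank-mono A {t} {suc t′} t≤st′ with m≤n⇒m<n∨m≡n t≤st′
  ... | inj₂ refl = ≤-refl
  ... | inj₁ t<st′ = ≤-trans (rank-mono A (s≤s⁻¹ t<st′)) (m≤m+n _ _)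

  rank-<⇒< : ∀ A {t t′} → rank A t < rank A t′ → t < t′
  rank-<⇒< A {t} {t′} lt = ≰⇒> (λ t′≤t → <⇒≱ lt (rank-mono A t′≤t))

  nth : ∀ A {N} c → c < rank A N → Σ ℕ (λ t → t < N × rank A t ≡ c × vtx t ∈ A)
  nth A {suc N} c c<rank with c <? rank A N
  ... | yes c<rankN with nth A c c<rankN
  ...   | t , t<N , rank≡c , t∈A = t , m<n⇒m<1+n t<N , rank≡c , t∈A
  nth A {suc N} c c<rank | no c≮rankN with lookup A (vtx N) in e
  ...   | true = N , ≤-refl , ≤-antisym (≮⇒≥ c≮rankN) (s≤s⁻¹ (subst (c <_) (+-comm (rank A N) 1) c<rank)) , lookup⇒[]= (vtx N) A e
  ...   | false = ⊥-elim (c≮rankN (subst (c <_) (+-identityʳ (rank A N)) c<rank))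

  ∣A∩below∣ : ∀ A {y} → y ≤ n → ∣ A ∩ below y ∣ ≡ rank A y
  ∣A∩below∣ A {y} y≤n = begin
    ∣ A ∩ below y ∣                                   ≡⟨ ∣p∣≡∑𝟙 (A ∩ below y) ⟩
    sum {n} (λ v → 𝟙 (lookup (A ∩ below y) v))        ≡⟨ sum-cong-≗ {n} pointwise ⟩
    sum {n} (λ v → 𝟙 (lookup A (vtx (toℕ v)) ∧ (toℕ v <ᵇ y))) ≡⟨ ∑∘toℕ≡sum< n (λ z → 𝟙 (lookup A (vtx z) ∧ (z <ᵇ y))) ⟩
    sum< n (λ z → 𝟙 (lookup A (vtx z) ∧ (z <ᵇ y)))    ≡⟨ sum<-cong n (λ z _ → 𝟙∧ (lookup A (vtx z)) (z <ᵇ y)) ⟩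
    sum< n (λ z → if z <ᵇ y then 𝟙 (lookup A (vtx z)) else 0) ≡⟨ sum<-truncate n y _ y≤n ⟩
    rank A y                                          ∎
    where
    open ≡-Reasoning
    pointwise : ∀ v → 𝟙 (lookup (A ∩ below y) v) ≡ 𝟙 (lookup A (vtx (toℕ v)) ∧ (toℕ v <ᵇ y))
    pointwise v rewrite lookup-zipWith _∧_ v A (below y) | lookup∘tabulate (λ v → toℕ v <ᵇ y) v | vtx-toℕ v = refl
    𝟙∧ : ∀ a c → 𝟙 (a ∧ c) ≡ (if c then 𝟙 a else 0)
    𝟙∧ a true = cong 𝟙 (∧-identityʳ a)
    𝟙∧ a false = cong 𝟙 (∧-zeroʳ a)

  three-consecutive : ∀ A → 2 * n < 3 * ∣ A ∣ → Σ ℕ (λ c → vtx c ∈ A × vtx (1 + c) ∈ A × vtx (2 + c) ∈ A)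
  three-consecutive A 2n<3∣A∣ = from (Fin.any? (λ t → triple? (toℕ t)))
    where
    Triple : ℕ → Set
    Triple c = vtx c ∈ A × vtx (1 + c) ∈ A × vtx (2 + c) ∈ A
    triple? : ∀ c → Dec (Triple c)
    triple? c = (vtx c ∈? A) ×-dec ((vtx (1 + c) ∈? A) ×-dec (vtx (2 + c) ∈? A))

    f : ℕ → ℕ
    f z = 𝟙 (lookup A (vtx z))

    window-sum : sum< n (λ z → f z + f (1 + z) + f (2 + z)) ≡ 3 * ∣ A ∣
    window-sum = begin
      sum< n (λ z → f z + f (1 + z) + f (2 + z))                  ≡⟨ sum<-distrib-+ n (λ z → f z + f (1 + z)) (λ z → f (2 + z)) ⟩
      sum< n (λ z → f z + f (1 + z)) + sum< n (λ z → f (2 + z))   ≡⟨ cong (_+ sum< n (λ z → f (2 + z))) (sum<-distrib-+ n f (λ z → f (1 + z))) ⟩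
      sum< n f + sum< n (λ z → f (1 + z)) + sum< n (λ z → f (2 + z)) ≡⟨ cong₂ (λ a b → sum< n f + a + b) (rotate 1) (rotate 2) ⟩
      sum< n f + sum< n f + sum< n f                              ≡⟨ cong (λ a → a + a + a) (rank-n A) ⟩
      ∣ A ∣ + ∣ A ∣ + ∣ A ∣                                        ≡⟨ a+a+a≡3*a ∣ A ∣ ⟩
      3 * ∣ A ∣                                                   ∎
      where
      open ≡-Reasoning
      rotate : ∀ c → sum< n (λ z → f (c + z)) ≡ sum< n f
      rotate = sum<-rotate n f (λ z → cong (λ v → 𝟙 (lookup A v)) (vtx-n+ z))
      a+a+a≡3*a : ∀ a → a + a + a ≡ 3 * a
      a+a+a≡3*a a = trans (+-assoc a a a) (cong (a +_) (cong (a +_) (sym (+-identityʳ a))))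

    at-most-2 : ∀ c → ¬ Triple c → f c + f (1 + c) + f (2 + c) ≤ 2
    at-most-2 c ¬triple with lookup A (vtx c) in e₀ | lookup A (vtx (1 + c)) in e₁ | lookup A (vtx (2 + c)) in e₂
    ... | true | true | true = ⊥-elim (¬triple (lookup⇒[]= _ A e₀ , lookup⇒[]= _ A e₁ , lookup⇒[]= _ A e₂))
    ... | false | b | b′ = +-mono-≤ (𝟙≤1 b) (𝟙≤1 b′)
    ... | true | false | b′ = s≤s (𝟙≤1 b′)
    ... | true | true | false = ≤-refl

    from : Dec (Σ (Fin n) (λ t → Triple (toℕ t))) → Σ ℕ Triple
    from (yes (t , triple)) = toℕ t , triple
    from (no none) = ⊥-elim (<⇒≱ 2n<3∣A∣ (begin
      3 * ∣ A ∣                                  ≡⟨ window-sum ⟨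
      sum< n (λ z → f z + f (1 + z) + f (2 + z)) ≤⟨ sum<-mono-≤ n (λ z z<n → at-most-2 z (λ tr → none (fromℕ< z<n , subst Triple (sym (Fin.toℕ-fromℕ< z<n)) tr))) ⟩
      sum< n (λ _ → 2)                           ≡⟨ sum<-const n 2 ⟩
      n * 2                                      ≡⟨ *-comm n 2 ⟩
      2 * n                                      ∎))
      where open ≤-Reasoning

module UpperBound (m : ℕ) where
  open Positions m
  open Arcs m
  open Gaps m
  open Counting m

  excluded⇒interior : ∀ {A B p k} (sk≤n : suc k ≤ n) → V (CutPath.path p k sk≤n) ∩ A ≡ B →
    ∀ {x} → x ∈ A → x ∉ B → arc (suc p) k x ≡ true
  excluded⇒interior {A} {B} {p} {k} sk≤n V∩A≡B {x} x∈A x∉B with arc (suc p) k x in e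
  ... | true = refl
  ... | false = ⊥-elim (x∉B (subst (x ∈_) V∩A≡B (x∈p∩q⁺ (CutPath.∈pathV p k sk≤n e , x∈A))))

  -- B is the first k + 1 vertices of A without the second one, x. The path of a longest gap
  -- of B is a Steiner B-tree, so its gap contains x and y, hence also b₁ or b₂.
  module _ {k} (A : Subset n) (sgp : IsSGPSet G k A) {b₂ x b₁ y} (b₂<x : b₂ < x) (x<b₁ : x < b₁) (b₁<y : b₁ < y) (y<n : y < n)
           (b₂∈A : vtx b₂ ∈ A) (x∈A : vtx x ∈ A) (b₁∈A : vtx b₁ ∈ A) (y∈A : vtx y ∈ A) (rank≡ : rank A y ≡ suc k) where
    private
      x<y = <-trans x<b₁ b₁<y
      x<n = <-trans x<y y<n

      B : Subset n
      B = (A ∩ below y) - vtx x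

      ∈B : ∀ {z} → z < y → vtx z ∈ A → z ≢ x → vtx z ∈ B
      ∈B {z} z<y z∈A z≢x = x∈p∧x≢y⇒x∈p-y (x∈p∩q⁺ (z∈A , ∈below (subst (_< y) (sym (toℕ-vtx z<n)) z<y)))
                             (λ e → z≢x (vtx-injective-window 0 z≤n z≤n z<n x<n e))
        where z<n = <-trans z<y y<n

      b₁∈B : vtx b₁ ∈ B
      b₁∈B = ∈B b₁<y b₁∈A (λ e → <-irrefl (sym e) x<b₁)

      b₂∈B : vtx b₂ ∈ B
      b₂∈B = ∈B (<-trans b₂<x x<y) b₂∈A (λ e → <-irrefl e b₂<x)

      x∉B : vtx x ∉ B
      x∉B = x∉p-x (vtx x)

      y∉B : vtx y ∉ B
      y∉B y∈B = <-irrefl (toℕ-vtx y<n) (∈below⁻ (p∩q⊆q A (below y) (p─q⊆p _ _ y∈B)))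

      B⊆A : B ⊆ A
      B⊆A v∈B = p∩q⊆p A (below y) (p─q⊆p _ _ v∈B)

      ∣B∣≡k : ∣ B ∣ ≡ k
      ∣B∣≡k = suc-injective (begin
        suc ∣ B ∣         ≡⟨ ∣p-x∣+1≡∣p∣ (x∈p∩q⁺ (x∈A , ∈below (subst (_< y) (sym (toℕ-vtx x<n)) x<y))) ⟩
        ∣ A ∩ below y ∣   ≡⟨ ∣A∩below∣ A (<⇒≤ y<n) ⟩
        rank A y          ≡⟨ rank≡ ⟩
        suc k             ∎)
        where open ≡-Reasoning

      g : LongestGap B
      g = proj₁ (longestGap B {0} {0} (s≤s z≤n) (λ _ _ → refl))
      open LongestGap g

      V∩A≡B : V (CutPath.path start inner fits) ∩ A ≡ B
      V∩A≡B = sgp B B⊆A ∣B∣≡k _ (cutPath-steinerTree g b₂∈B)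

      ix : arc (suc start) inner (vtx x) ≡ true
      ix = excluded⇒interior fits V∩A≡B x∈A x∉B

      iy : arc (suc start) inner (vtx y) ≡ true
      iy = excluded⇒interior fits V∩A≡B y∈A y∉B

      in-gap : ∀ {z} → arc (suc start) inner (vtx z) ≡ true → vtx z ∉ B
      in-gap e z∈B = false≢true (trans (sym (gap _ z∈B)) e)

    four-in-order-absurd : ⊥
    four-in-order-absurd = either (arc-between (suc start) inner (<⇒≤ fits) x<y (<-≤-trans y<n (m≤n+m n x)) ix iy)
      where
      either : (∀ {z} → x ≤ z → z ≤ y → arc (suc start) inner (vtx z) ≡ true)
             ⊎ (∀ {z} → y ≤ z → z ≤ x + n → arc (suc start) inner (vtx z) ≡ true) → ⊥
      either (inj₁ between) = in-gap {b₁} (between (<⇒≤ x<b₁) (<⇒≤ b₁<y)) b₁∈B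
      either (inj₂ around) = in-gap {n + b₂} (around (≤-trans (<⇒≤ y<n) (m≤m+n n b₂)) (subst (_≤ x + n) (+-comm b₂ n) (+-monoˡ-≤ n (<⇒≤ b₂<x))))
                           (subst (_∈ B) (sym (vtx-n+ b₂)) b₂∈B)

  sgp≤k+1 : ∀ {k} → 2 ≤ k → ∀ A → IsSGPSet G k A → ∣ A ∣ ≤ suc k
  sgp≤k+1 {k} 2≤k A sgp = ≮⇒≥ {suc k} {∣ A ∣} too-many
    where
    too-many : suc k < ∣ A ∣ → ⊥
    too-many k+1<∣A∣ = four (element 0 z≤n) (element 1 (s≤s z≤n)) (element 2 (s≤s (<⇒≤ 2≤k))) (element (suc k) ≤-refl)
      where
      Element : ℕ → Set
      Element c = Σ ℕ (λ t → t < n × rank A t ≡ c × vtx t ∈ A)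
      element : ∀ c → c ≤ suc k → Element c
      element c c≤k+1 = nth A c (<-≤-trans (s≤s c≤k+1) (subst (suc (suc k) ≤_) (sym (rank-n A)) k+1<∣A∣))
      ordered : ∀ {t t′ c c′} → rank A t ≡ c → rank A t′ ≡ c′ → c < c′ → t < t′
      ordered r r′ c<c′ = rank-<⇒< A (subst₂ _<_ (sym r) (sym r′) c<c′)
      four : Element 0 → Element 1 → Element 2 → Element (suc k) → ⊥
      four (b₂ , _ , r₀ , b₂∈A) (x , _ , r₁ , x∈A) (b₁ , _ , r₂ , b₁∈A) (y , y<n , r , y∈A) =
        four-in-order-absurd {k} A sgp {b₂} {x} {b₁} {y} (ordered {t = b₂} {x} r₀ r₁ (s≤s z≤n)) (ordered {t = x} {b₁} r₁ r₂ (s≤s (s≤s z≤n))) (ordered {t = b₁} {y} r₂ r (s≤s 2≤k)) y<n b₂∈A x∈A b₁∈A y∈A r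

  -- A gap of B through a has length at most 2 since both
  -- neighbours of a lie in B, so a longest gap of A (of length at least 2, around w) is a
  -- longest gap of B; its path is then a Steiner B-tree containing a.
  module _ {k} (A : Subset n) (sgp : IsSGPSet G k A) (∣A∣≡k+1 : ∣ A ∣ ≡ suc k)
           {c} (c∈A : vtx c ∈ A) (a∈A : vtx (1 + c) ∈ A) (c+2∈A : vtx (2 + c) ∈ A) {w} (w∉A : w ∉ A) where
    private
      a : Fin n
      a = vtx (suc c)

      B : Subset n
      B = A - a

      ∣B∣≡k : ∣ B ∣ ≡ k
      ∣B∣≡k = suc-injective (trans (∣p-x∣+1≡∣p∣ a∈A) ∣A∣≡k+1)

      c∈B : vtx c ∈ B
      c∈B = x∈p∧x≢y⇒x∈p-y c∈A (λ e → next≢id (vtx c) (sym e))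

      c+2∈B : vtx (2 + c) ∈ B
      c+2∈B = x∈p∧x≢y⇒x∈p-y c+2∈A (next≢id a)

      gap-at-w : Gap A (2 + m + toℕ w) 1
      gap-at-w x x∈A = ≢⇒==≡false (λ e → w∉A (subst (_∈ A) (sym (trans (sym at-w) e)) x∈A))
        where
        at-w : vtx (n + toℕ w + 0) ≡ w
        at-w = trans (cong vtx (+-identityʳ (n + toℕ w))) (trans (vtx-n+ (toℕ w)) (vtx-toℕ w))

      longestA = longestGap A {2 + m + toℕ w} {1} (s≤s (s≤s z≤n)) gap-at-w
      open LongestGap (proj₁ longestA)

      Gap-B⇒Gap-A : ∀ {q k′} → Gap B q k′ → arc (suc q) k′ a ≡ false → Gap A q k′
      Gap-B⇒Gap-A {q} {k′} gapB a∉ x x∈A with x Fin.≟ a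
      ... | yes refl = a∉
      ... | no x≢a = gapB x (x∈p∧x≢y⇒x∈p-y x∈A x≢a)

      longest-B : ∀ q k′ → suc k′ ≤ n → Gap B q k′ → k′ ≤ inner
      longest-B q k′ sk′≤n gapB with arc (suc q) k′ a in e
      ... | false = longest q k′ sk′≤n (Gap-B⇒Gap-A {q} {k′} gapB e)
      ... | true = ≤-trans (gap-through-neighbours {B} {q} {k′} {c} gapB c∈B c+2∈B e) (proj₂ longestA)

      gB : LongestGap B
      gB = record { start = start ; inner = inner ; fits = fits ; gap = λ x x∈B → gap x (p─q⊆p A _ x∈B) ; longest = longest-B }

      V∩A≡B : V (CutPath.path start inner fits) ∩ A ≡ B
      V∩A≡B = sgp B (p─q⊆p A _) ∣B∣≡k _ (cutPath-steinerTree gB c∈B)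

    three-consecutive-absurd : ⊥
    three-consecutive-absurd = false≢true (trans (sym (gap a a∈A)) (excluded⇒interior fits V∩A≡B a∈A (x∉p-x a)))

  sgp≤k : ∀ {k} → 2 ≤ k → (2 * n) / 3 ≤ k → k ≤ n ∸ 2 → ∀ A → IsSGPSet G k A → ∣ A ∣ ≤ k
  sgp≤k {k} 2≤k lo hi A sgp = ≮⇒≥ {k} {∣ A ∣} too-many
    where
    too-many : k < ∣ A ∣ → ⊥
    too-many k<∣A∣ = via (three-consecutive A 2n<3∣A∣) (∣p∣<N⇒∃∉ A ∣A∣<n)
      where
      ∣A∣≡k+1 : ∣ A ∣ ≡ suc k
      ∣A∣≡k+1 = ≤-antisym (sgp≤k+1 2≤k A sgp) k<∣A∣
      2n<3∣A∣ : 2 * n < 3 * ∣ A ∣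
      2n<3∣A∣ = begin-strict
        2 * n                 <⟨ m<[1+m/n]*n (2 * n) 3 ⟩
        suc ((2 * n) / 3) * 3 ≤⟨ *-monoˡ-≤ 3 (s≤s lo) ⟩
        suc k * 3             ≡⟨ *-comm (suc k) 3 ⟩
        3 * suc k             ≡⟨ cong (3 *_) ∣A∣≡k+1 ⟨
        3 * ∣ A ∣             ∎
        where open ≤-Reasoning
      ∣A∣<n : ∣ A ∣ < n
      ∣A∣<n = subst (_< n) (sym ∣A∣≡k+1) (s≤s (s≤s hi))
      via : Σ ℕ (λ c → vtx c ∈ A × vtx (1 + c) ∈ A × vtx (2 + c) ∈ A) → Σ (Fin n) (_∉ A) → ⊥
      via (c , c∈A , a∈A , c+2∈A) (w , w∉A) = three-consecutive-absurd {k} A sgp ∣A∣≡k+1 {c} c∈A a∈A c+2∈A {w} w∉A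

short-pair-fits : ∀ {a b r N} → 3 ≤ r → 2 ≤ N → a * r < N → b * r < N → suc a + suc b ≤ N
short-pair-fits {a} {b} {r} {N} 3≤r 2≤N ar<N br<N = ≮⇒≥ λ N<sa+sb → <⇒≱ 2≤N (≤-trans (N≤1+s N<sa+sb) (s≤s (≤-reflexive (s≡0 N<sa+sb))))
  where
  s = a + b
  N≤1+s : N < suc a + suc b → N ≤ suc s
  N≤1+s lt = s≤s⁻¹ (subst (N <_) (cong suc (+-suc a b)) lt)
  thrice<N : ∀ x → x * r < N → x * 3 < N
  thrice<N x xr<N = ≤-<-trans (*-monoʳ-≤ x 3≤r) xr<N
  s≡0 : N < suc a + suc b → s ≡ 0
  s≡0 lt = n≤0⇒n≡0 (+-cancelˡ-≤ (suc s + suc s) s 0 (subst₂ _≤_ (regroup a b) (sym (+-identityʳ _))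
             (+-mono-≤ (≤-trans (thrice<N a ar<N) (N≤1+s lt)) (≤-trans (thrice<N b br<N) (N≤1+s lt)))))
    where
    regroup : ∀ a b → suc (a * 3) + suc (b * 3) ≡ (suc (a + b) + suc (a + b)) + (a + b)
    regroup = solve-∀

-- The only place where 3r ≤ 2n or r = n is used.
long-window-absurd : ∀ {G K r N} → 3 * r ≤ 2 * N ⊎ r ≡ N → 2 ≤ G → G ≤ suc K → K * r < N → 2 * N < suc G * r → ⊥
long-window-absurd {zero} _ () _ _ _
long-window-absurd {suc zero} _ (s≤s ()) _ _ _
long-window-absurd {suc (suc zero)} {zero} _ _ (s≤s ()) _ _
long-window-absurd {suc (suc zero)} {suc K} {r} {N} 3r≤2N⊎r≡N _ _ Kr<N 2N<3r with 3r≤2N⊎r≡N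
... | inj₁ 3r≤2N = <⇒≱ 2N<3r 3r≤2N
... | inj₂ r≡N = <⇒≱ Kr<N (subst (_≤ suc K * r) r≡N (m≤m+n r (K * r)))
long-window-absurd {suc (suc (suc g))} {K} {r} {N} _ _ G≤sK Kr<N 2N<G+1r = <⇒≱ (begin-strict
  (4 + g) * r           ≤⟨ *-monoˡ-≤ r (m≤n+m (4 + g) g) ⟩
  (g + (4 + g)) * r     ≡⟨ regroup g r ⟩
  2 * ((2 + g) * r)     ≤⟨ *-monoʳ-≤ 2 (*-monoˡ-≤ r (s≤s⁻¹ G≤sK)) ⟩
  2 * (K * r)           <⟨ *-monoʳ-< 2 Kr<N ⟩
  2 * N                 <⟨ 2N<G+1r ⟩
  (4 + g) * r           ∎) ≤-refl
  where
  open ≤-Reasoning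
  regroup : ∀ g r → (g + (4 + g)) * r ≡ 2 * ((2 + g) * r)
  regroup = solve-∀

-- The spread set consists of the positions where D z = ⌊z r / n⌋ increases: r vertices
-- spaced as evenly as possible around the cycle.
module EvenlySpread (m : ℕ) (r : ℕ) (r≤n : r ≤ 3 + m) where
  open Positions m

  D : ℕ → ℕ
  D z = (z * r) / n

  D-mono : ∀ {a b} → a ≤ b → D a ≤ D b
  D-mono a≤b = /-monoˡ-≤ n (*-monoˡ-≤ r a≤b)

  D-suc≤ : ∀ z → D (suc z) ≤ suc (D z)
  D-suc≤ z = s≤s⁻¹ (m<n*o⇒m/o<n (begin-strict
    suc z * r              ≡⟨ +-comm r (z * r) ⟩
    z * r + r              <⟨ +-monoˡ-< r (m<[1+m/n]*n (z * r) n) ⟩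
    suc (D z) * n + r      ≤⟨ +-monoʳ-≤ (suc (D z) * n) r≤n ⟩
    suc (D z) * n + n      ≡⟨ +-comm (suc (D z) * n) n ⟩
    suc (suc (D z)) * n    ∎))
    where open ≤-Reasoning

  jump : ℕ → Bool
  jump z = D z <ᵇ D (suc z)

  𝟙jump≡ΔD : ∀ z → 𝟙 (jump z) ≡ D (suc z) ∸ D z
  𝟙jump≡ΔD z with <-cmp (D z) (D (suc z))
  ... | tri< lt _ _ rewrite m<n⇒m<ᵇn≡true lt = sym (trans (cong (_∸ D z) (≤-antisym (D-suc≤ z) lt)) (m+n∸n≡m 1 (D z)))
  ... | tri≈ _ e _ rewrite e | n≤m⇒m<ᵇn≡false (≤-refl {D (suc z)}) = sym (n∸n≡0 (D (suc z)))
  ... | tri> _ _ gt = ⊥-elim (<⇒≱ gt (D-mono (n≤1+n z)))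

  jump⇒D-suc : ∀ z → jump z ≡ true → D (suc z) ≡ suc (D z)
  jump⇒D-suc z e = ≤-antisym (D-suc≤ z) (m<ᵇn≡true⇒m<n e)

  D-n+ : ∀ z → D (n + z) ≡ D z + r
  D-n+ z = trans (cong (_/ n) (trans (*-distribʳ-+ r n z) (trans (+-comm (n * r) (z * r)) (cong (z * r +_) (*-comm n r)))))
                 ([m+k*n]/n≡m/n+k (z * r) r n)

  jump-n+ : ∀ z → jump (n + z) ≡ jump z
  jump-n+ z = trans (cong₂ _<ᵇ_ (D-n+ z) (trans (cong D (sym (+-suc n z))) (D-n+ (suc z)))) (<ᵇ-+ʳ (D z) (D (suc z)) r)

  jump-*n+ : ∀ q z → jump (q * n + z) ≡ jump z
  jump-*n+ zero z = refl
  jump-*n+ (suc q) z = trans (cong jump (+-assoc n (q * n) z)) (trans (jump-n+ (q * n + z)) (jump-*n+ q z))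

  spread : Subset n
  spread = tabulate (λ v → jump (toℕ v))

  lookup-spread : ∀ z → lookup spread (vtx z) ≡ jump z
  lookup-spread z = begin
    lookup spread (vtx z)               ≡⟨ cong (λ u → lookup spread (vtx u)) z≡qn+t ⟩
    lookup spread (vtx (q * n + t))      ≡⟨ cong (lookup spread) (vtx-*n+ q t) ⟩
    lookup spread (vtx t)                ≡⟨ lookup∘tabulate (λ v → jump (toℕ v)) (vtx t) ⟩
    jump (toℕ (vtx t))                   ≡⟨ cong jump (toℕ-vtx (m%n<n z n)) ⟩
    jump t                               ≡⟨ jump-*n+ q t ⟨
    jump (q * n + t)                     ≡⟨ cong jump z≡qn+t ⟨
    jump z                               ∎
    where
    open ≡-Reasoning
    t = z % n
    q = z / n
    z≡qn+t : z ≡ q * n + t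
    z≡qn+t = trans (m≡m%n+[m/n]*n z n) (+-comm t (q * n))

  ∑jump+D≡D : ∀ x w → sum< w (λ i → 𝟙 (jump (x + i))) + D x ≡ D (x + w)
  ∑jump+D≡D x w = trans (cong (_+ D x) (sum<-cong w (λ i _ → 𝟙jump≡ΔD (x + i)))) (sum<-telescope D (λ z → D-mono (n≤1+n z)) x w)

  ∣spread∣ : ∣ spread ∣ ≡ r
  ∣spread∣ = begin
    ∣ spread ∣                               ≡⟨ ∣p∣≡∑𝟙 spread ⟩
    sum (λ v → 𝟙 (lookup spread v))          ≡⟨ sum-cong-≗ {n} (λ v → cong 𝟙 (lookup∘tabulate (λ v → jump (toℕ v)) v)) ⟩
    sum {n} (λ v → 𝟙 (jump (toℕ v)))         ≡⟨ ∑∘toℕ≡sum< n (λ z → 𝟙 (jump z)) ⟩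
    sum< n (λ z → 𝟙 (jump z))                ≡⟨ +-identityʳ _ ⟨
    sum< n (λ z → 𝟙 (jump z)) + D 0          ≡⟨ ∑jump+D≡D 0 n ⟩
    D n                                      ≡⟨ cong (_/ n) (*-comm n r) ⟩
    r * n / n                                ≡⟨ m*n/n≡m r n ⟩
    r                                        ∎
    where open ≡-Reasoning

  no-jump⇒short : ∀ x w → (∀ i → i < w → jump (x + i) ≡ false) → w * r < n
  no-jump⇒short x w no-jump = ≰⇒> λ n≤wr → <-irrefl D-flat (begin-strict
    D x                      <⟨ m<m+n (D x) z<s ⟩
    D x + 1                  ≡⟨ [m+k*n]/n≡m/n+k (x * r) 1 n ⟨
    (x * r + 1 * n) / n      ≤⟨ /-monoˡ-≤ n (+-monoʳ-≤ (x * r) (≤-trans (≤-reflexive (*-identityˡ n)) n≤wr)) ⟩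
    (x * r + w * r) / n      ≡⟨ cong (_/ n) (*-distribʳ-+ r x w) ⟨
    D (x + w)                ∎)
    where
    open ≤-Reasoning
    D-flat : D x ≡ D (x + w)
    D-flat = trans (sym (+-identityˡ (D x))) (trans (cong (_+ D x) (sym (sum<-zero w _ (λ i i<w → cong 𝟙 (no-jump i i<w))))) (∑jump+D≡D x w))

  three-jumps⇒long : ∀ x w → 3 + D x ≤ D (x + w) → 2 * n < w * r
  three-jumps⇒long x w 3+Dx≤ = +-cancelʳ-< (suc (D x) * n) (2 * n) (w * r) (begin-strict
    2 * n + suc (D x) * n     ≡⟨ regroup (D x) n ⟩
    (3 + D x) * n             ≤⟨ *-monoˡ-≤ n 3+Dx≤ ⟩
    D (x + w) * n             ≤⟨ m/n*n≤m ((x + w) * r) n ⟩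
    (x + w) * r               ≡⟨ *-distribʳ-+ r x w ⟩
    x * r + w * r             <⟨ +-monoˡ-< (w * r) (m<[1+m/n]*n (x * r) n) ⟩
    suc (D x) * n + w * r     ≡⟨ +-comm (suc (D x) * n) (w * r) ⟩
    w * r + suc (D x) * n     ∎)
    where
    open ≤-Reasoning
    regroup : ∀ q n → 2 * n + suc q * n ≡ (3 + q) * n
    regroup = solve-∀

  jump-free-window : ∀ {a b} → (∀ z → a < z → z < b → jump z ≡ false) → ∀ i → i < b ∸ suc a → jump (suc a + i) ≡ false
  jump-free-window {a} {b} free i i<b-sa = free (suc a + i) (s≤s (m≤m+n a i)) (subst (suc a + i <_) (m+[n∸m]≡n sa≤b) (+-monoʳ-< (suc a) i<b-sa))
    where
    sa≤b : suc a ≤ b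
    sa≤b = ≰⇒> λ b≤a → <⇒≱ (<-≤-trans i<b-sa (≤-reflexive (m≤n⇒m∸n≡0 (≤-trans b≤a (n≤1+n a))))) z≤n

  next-jump : ∀ c → jump c ≡ true → Σ ℕ (λ d → c < d × jump d ≡ true × (∀ z → c < z → z < d → jump z ≡ false))
  next-jump c jc with least (λ t → jump (suc c + t) ≡ true) (λ t → jump (suc c + t) Bool.≟ true) (2 + m) jc+n
    where
    jc+n : jump (suc c + (2 + m)) ≡ true
    jc+n = trans (cong jump (trans (sym (+-suc c (2 + m))) (+-comm c n))) (trans (jump-n+ c) jc)
  ... | t , jt , _ , below = suc c + t , s≤s (m≤m+n c t) , jt , free
    where
    free : ∀ z → c < z → z < suc c + t → jump z ≡ false
    free z c<z z<sc+t = ¬true⇒false (subst (λ u → ¬ jump u ≡ true) (m+[n∸m]≡n c<z) (below (z ∸ suc c) (n≤m<n+o⇒m∸n<o c<z z<sc+t)))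

  prev-jump : ∀ c → n ≤ c → jump c ≡ true → Σ ℕ (λ b → b < c × jump b ≡ true × (∀ z → b < z → z < c → jump z ≡ false))
  prev-jump c n≤c jc with least (λ t → jump (c ∸ suc t) ≡ true) (λ t → jump (c ∸ suc t) Bool.≟ true) (2 + m) jc-n
    where
    jc-n : jump (c ∸ n) ≡ true
    jc-n = trans (sym (jump-n+ (c ∸ n))) (trans (cong jump (m+[n∸m]≡n n≤c)) jc)
  ... | t , jt , t≤2+m , below = c ∸ suc t , ∸-monoʳ-< {c} (s≤s z≤n) (≤-trans (s≤s t≤2+m) n≤c) , jt , free
    where
    free : ∀ z → c ∸ suc t < z → z < c → jump z ≡ false
    free z c-st<z z<c = ¬true⇒false (subst (λ u → ¬ jump u ≡ true) back (below (c ∸ suc z) c-sz<t))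
      where
      c≡z+[c-z] : c ≡ suc z + (c ∸ suc z)
      c≡z+[c-z] = sym (m+[n∸m]≡n z<c)
      back : c ∸ suc (c ∸ suc z) ≡ z
      back = trans (cong (_∸ suc (c ∸ suc z)) (trans c≡z+[c-z] (sym (+-suc z (c ∸ suc z))))) (m+n∸n≡m z (suc (c ∸ suc z)))
      c-sz<t : c ∸ suc z < t
      c-sz<t = n≤m<n+o⇒m∸n<o z<c (subst (c <_) (+-suc z t)
                 (subst (_< z + suc t) (m∸n+n≡m (≤-trans (s≤s t≤2+m) n≤c)) (+-monoˡ-< (suc t) c-st<z)))

module SpreadIsSGP (m k : ℕ) (2≤k : 2 ≤ k) (k<n : suc k ≤ 3 + m) (3r≤2n⊎r≡n : 3 * suc k ≤ 2 * (3 + m) ⊎ suc k ≡ 3 + m) where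
  open Positions m
  open Arcs m
  open EdgeCounting m
  open Gaps m
  open EvenlySpread m (suc k) k<n

  ∈spread : ∀ {z} → vtx z ∈ spread → jump z ≡ true
  ∈spread {z} z∈ = trans (sym (lookup-spread z)) ([]=⇒lookup z∈)

  gap-short : ∀ {q K} → Gap spread q K → K * suc k < n
  gap-short {q} {K} gap = no-jump⇒short (suc q) K λ i i<K → ¬true⇒false λ jump-i →
    false≢true (trans (sym (gap _ (lookup⇒[]= _ spread (trans (lookup-spread (suc q + i)) jump-i))))
                      (position⇒arc (suc q) K (m≤m+n (suc q) i) (+-monoʳ-< (suc q) i<K) refl))

  -- A Steiner B-tree
  -- through v contains all of A, so it misses at most one gap of A, which is short; yet it is
  -- no larger than the path deleting the gap of B from b to d, which spans three jumps.
  module _ (B : Subset n) (B⊆A : B ⊆ spread) (∣B∣≡k : ∣ B ∣ ≡ k) (T : Subgraph G) (tree : SteinerTree G B T)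
           {v} (v∈A : v ∈ spread) (v∉B : v ∉ B) (v∈T : v ∈ V T)
           {b c d} (b<c : b < c) (c<d : c < d) (vc : vtx c ≡ v) (jb : jump b ≡ true) (jd : jump d ≡ true)
           (free-before : ∀ z → b < z → z < c → jump z ≡ false) (free-after : ∀ z → c < z → z < d → jump z ≡ false) where
    private
      A⊆T : spread ⊆ V T
      A⊆T {u} u∈A with u Fin.≟ v
      ... | yes refl = v∈T
      ... | no u≢v = proj₂ (proj₁ tree) (p⊆q∧∣q∣≤∣p∣⇒q⊆p B⊆A-v (≤-reflexive ∣A-v∣≡∣B∣) (x∈p∧x≢y⇒x∈p-y u∈A u≢v))
        where
        B⊆A-v : B ⊆ spread - v
        B⊆A-v {x} x∈B = x∈p∧x≢y⇒x∈p-y (B⊆A x∈B) (λ { refl → v∉B x∈B })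
        ∣A-v∣≡∣B∣ : ∣ spread - v ∣ ≡ ∣ B ∣
        ∣A-v∣≡∣B∣ = suc-injective (trans (∣p-x∣+1≡∣p∣ v∈A) (trans ∣spread∣ (cong suc (sym ∣B∣≡k))))

      L : ℕ
      L = (c ∸ suc b) + suc (d ∸ suc c)

      end : suc b + L ≡ d
      end = begin
        suc b + ((c ∸ suc b) + suc (d ∸ suc c)) ≡⟨ +-assoc (suc b) (c ∸ suc b) _ ⟨
        suc b + (c ∸ suc b) + suc (d ∸ suc c)   ≡⟨ cong (_+ suc (d ∸ suc c)) (m+[n∸m]≡n b<c) ⟩
        c + suc (d ∸ suc c)                     ≡⟨ +-suc c (d ∸ suc c) ⟩
        suc c + (d ∸ suc c)                     ≡⟨ m+[n∸m]≡n c<d ⟩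
        d                                       ∎
        where open ≡-Reasoning

      fits : suc L ≤ n
      fits = short-pair-fits (s≤s 2≤k) (s≤s (s≤s z≤n))
               (no-jump⇒short (suc b) (c ∸ suc b) (jump-free-window free-before))
               (no-jump⇒short (suc c) (d ∸ suc c) (jump-free-window free-after))

      gapB : Gap B b L
      gapB u u∈B with arc (suc b) L u in e
      ... | false = refl
      ... | true with arc⇒position (suc b) L e
      ...   | z , sb≤z , z<end , vz with <-cmp z c
      ...     | tri< z<c _ _ = ⊥-elim (false≢true (trans (sym (free-before z sb≤z z<c)) (∈spread {z} (subst (_∈ spread) (sym vz) (B⊆A u∈B)))))
      ...     | tri≈ _ refl _ = ⊥-elim (v∉B (subst (_∈ B) (trans (sym vz) vc) u∈B))
      ...     | tri> _ _ c<z = ⊥-elim (false≢true (trans (sym (free-after z c<z (subst (z <_) end z<end))) (∈spread {z} (subst (_∈ spread) (sym vz) (B⊆A u∈B)))))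

      jc : jump c ≡ true
      jc = ∈spread {c} (subst (_∈ spread) (sym vc) v∈A)

      three-jumps : 3 + D b ≤ D (b + suc (suc L))
      three-jumps = begin
        3 + D b               ≡⟨ cong (2 +_) (jump⇒D-suc b jb) ⟨
        2 + D (suc b)         ≤⟨ +-monoʳ-≤ 2 (D-mono b<c) ⟩
        2 + D c               ≡⟨ cong suc (jump⇒D-suc c jc) ⟨
        1 + D (suc c)         ≤⟨ +-monoʳ-≤ 1 (D-mono c<d) ⟩
        1 + D d               ≡⟨ jump⇒D-suc d jd ⟨
        D (suc d)             ≡⟨ cong D (trans (cong suc (sym end)) (sym (trans (+-suc b (suc L)) (cong suc (+-suc b L))))) ⟩
        D (b + suc (suc L))   ∎
        where open ≤-Reasoning

      open CutPath b L fits

      L≤K : ∀ {K} → n ≤ edgeCount T + suc K → L ≤ K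
      L≤K {K} n≤eT+sK = s≤s⁻¹ (+-cancelˡ-≤ (edgeCount path) (suc L) (suc K) (begin
        edgeCount path + suc L ≡⟨ edgeCount-path ⟩
        n                      ≤⟨ n≤eT+sK ⟩
        edgeCount T + suc K    ≤⟨ +-monoˡ-≤ (suc K) (proj₂ tree path (path-connected , Gap⇒⊆pathV fits gapB)) ⟩
        edgeCount path + suc K ∎))
        where open ≤-Reasoning

      via : (Σ ℕ λ q → Σ ℕ λ K → suc K ≤ n × Gap spread q K × n ≤ edgeCount T + suc K) → ⊥
      via (q , K , _ , gapA , n≤eT+sK) =
        long-window-absurd 3r≤2n⊎r≡n (s≤s (≤-trans (s≤s z≤n) (m≤n+m (suc (d ∸ suc c)) (c ∸ suc b)))) (s≤s (L≤K n≤eT+sK)) (gap-short {q} {K} gapA) (three-jumps⇒long b (suc (suc L)) three-jumps)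

    spread-excluded : ⊥
    spread-excluded = via (edgeCount-connected-≥ T (proj₁ (proj₁ tree)) spread A⊆T v∈A)

  spread-isSGP : IsSGPSet G k spread
  spread-isSGP = IsSGPSet-intro G k spread excluded
    where
    excluded : ∀ B → B ⊆ spread → ∣ B ∣ ≡ k → ∀ T → SteinerTree G B T → ∀ {v} → v ∈ spread → v ∉ B → v ∉ V T
    excluded B B⊆A ∣B∣≡k T tree {v} v∈A v∉B v∈T = around (prev-jump c (m≤m+n n (toℕ v)) jc) (next-jump c jc)
      where
      c : ℕ
      c = n + toℕ v
      vc : vtx c ≡ v
      vc = trans (vtx-n+ (toℕ v)) (vtx-toℕ v)
      jc : jump c ≡ true
      jc = ∈spread {c} (subst (_∈ spread) (sym vc) v∈A)
      around : Σ ℕ (λ b → b < c × jump b ≡ true × (∀ z → b < z → z < c → jump z ≡ false)) →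
               Σ ℕ (λ d → c < d × jump d ≡ true × (∀ z → c < z → z < d → jump z ≡ false)) → ⊥
      around (b , b<c , jb , before) (d , c<d , jd , after) =
        spread-excluded B B⊆A ∣B∣≡k T tree v∈A v∉B v∈T b<c c<d vc jb jd before after

outside-range : ∀ {n′ k} → let n = 2 + n′ in k ≤ n ∸ 1 → ¬ ((2 * n) / 3 ≤ k × k ≤ n ∸ 2) → 3 * suc k ≤ 2 * n ⊎ suc k ≡ n
outside-range {n′} {k} k≤n-1 ¬range with (2 * (2 + n′)) / 3 ≤? k | k ≤? n′
... | yes lo | yes hi = ⊥-elim (¬range (lo , hi))
... | yes _ | no k≰n-2 = inj₂ (cong suc (≤-antisym k≤n-1 (≰⇒> k≰n-2)))
... | no k≱2n/3 | _ = inj₁ (subst (_≤ 2 * (2 + n′)) (*-comm (suc k) 3) (≤-trans (*-monoˡ-≤ 3 (≰⇒> k≱2n/3)) (m/n*n≤m (2 * (2 + n′)) 3)))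

theorem3p2 : (m k : ℕ) → 2 ≤ k → k ≤ (3 + m) ∸ 1 →
    ((2 * (3 + m)) / 3 ≤ k × k ≤ (3 + m) ∸ 2 → SgpIs (Cycle m) k k)
    × (¬ ((2 * (3 + m)) / 3 ≤ k × k ≤ (3 + m) ∸ 2) → SgpIs (Cycle m) k (suc k))
theorem3p2 m k 2≤k k≤n-1 = in-range , out-of-range
  where
  open UpperBound m
  k≤n : k ≤ 3 + m
  k≤n = ≤-trans k≤n-1 (n≤1+n _)
  in-range : (2 * (3 + m)) / 3 ≤ k × k ≤ (3 + m) ∸ 2 → SgpIs (Cycle m) k k
  in-range (lo , hi) = (below k , IsSGPSet-of-size (Cycle m) k (below k) (∣below∣ k k≤n) , ∣below∣ k k≤n) , sgp≤k 2≤k lo hi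
  out-of-range : ¬ ((2 * (3 + m)) / 3 ≤ k × k ≤ (3 + m) ∸ 2) → SgpIs (Cycle m) k (suc k)
  out-of-range ¬range = (spread , spread-isSGP , ∣spread∣) , sgp≤k+1 2≤k
    where
    open SpreadIsSGP m k 2≤k (s≤s k≤n-1) (outside-range k≤n-1 ¬range)
    open EvenlySpread m (suc k) (s≤s k≤n-1) using (spread; ∣spread∣)
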